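{- Let $\mathbb{C}$ be a strict Markov category and $\theta\colon\mathrm{Var}\to\mathrm{ob}(\mathbb{C})$. The subkernel relation $\sqsubseteq$ on $\mathbb{C}_\theta$-kernels is a preorder (reflexive and transitive).
   Context: $\mathrm{Var}$ is a countably infinite set with a strict linear order $\prec$; $[S]$ is the $\prec$-increasing list of finite $S\subseteq\mathrm{Var}$. A strict Markov category is a strict symmetric monoidal category where each object $A$ has $\mathsf{copy}_A\colon A\to A\otimes A$, $\mathsf{del}_A\colon A\to\mathsf I$ forming a commutative comonoid compatible with $\otimes$, with $\mathsf{del}$ natural. $\mathbb{C}_\theta$: objects finite lists of variables; morphisms $[x_1..x_m]\to[y_1..y_n]$ are $\mathbb{C}$-morphisms $\theta(x_1)\otimes\cdots\otimes\theta(x_m)\to\theta(y_1)\otimes\cdots\otimes\theta(y_n)$; composition, identities, copy, delete, $\otimes$ (concatenation on objects) from $\mathbb{C}$. Rewirings are symmetry-built permutations of factors according to a permutation of variables. A $\mathbb{C}_\theta$-kernel $f\colon X\to Y$ ($X\subseteq Y$ finite) is a morphism $[X]\to[Y]$ equal to $\sigma\circ(\mathrm{id}_{[X]}\otimes f')\circ\mathsf{copy}_{[X]}$ for some $f'\colon[X]\to[Y\setminus X]$ and rewiring $\sigma$. For kernels $f\colon X\to Y$ and $g$, $f\sqsubseteq g$ iff there exist a finite set $Z$ of variables not in $Y$, a kernel $h$, and rewirings $\sigma_1\colon[X\cup Z]\to[X][Z]$, $\sigma_2\colon[Y][Z]\to[Y\cup Z]$ with $g=h\circ\sigma_2\circ(f\otimes\mathrm{id}_{[Z]})\circ\sigma_1$.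 -}

module Defs where

open import Level using (Level; _⊔_; suc; 0ℓ)
open import Data.Nat using (ℕ)
open import Data.Product using (Σ; _×_; _,_; Σ-syntax)
open import Data.List using (List; []; _∷_; _++_; filter; foldr)
open import Data.List.Membership.Propositional using (_∈_; _∉_)
open import Data.List.Relation.Unary.Linked using (Linked)
open import Data.List.Relation.Binary.Permutation.Propositional using (_↭_; refl; prep; swap; trans)
open import Relation.Binary.Core using (Rel)
open import Relation.Binary.Structures using (IsStrictTotalOrder)
open import Relation.Binary.Definitions using (tri<; tri≈; tri>)
open import Relation.Binary.PropositionalEquality as Eq using (_≡_; subst; subst₂; cong)
open import Relation.Nullary.Decidable using (¬?)
open import Function.Bundles using (_↔_)
import Data.List.Membership.DecPropositional as DecMem

record VarStructure : Set₁ where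
  field
    Var       : Set
    _≺_       : Rel Var 0ℓ
    isSTO     : IsStrictTotalOrder _≡_ _≺_
    countable : Var ↔ ℕ

  open IsStrictTotalOrder isSTO public using (compare; _≟_)

  -- a finite set S of variables is represented by its ≺-increasing list [S]
  Sorted : List Var → Set
  Sorted = Linked _≺_

  open DecMem _≟_ using (_∈?_)

  infixr 6 _∪_
  _∪_ : List Var → List Var → List Var
  [] ∪ ys = ys
  (x ∷ xs) ∪ ys = merge-into x xs (xs ∪_) ys
    where
    merge-into : Var → List Var → (List Var → List Var) → List Var → List Var
    merge-into x xs rec [] = x ∷ xs
    merge-into x xs rec (y ∷ ys) with compare x y
    ... | tri< _ _ _ = x ∷ rec (y ∷ ys)
    ... | tri≈ _ _ _ = x ∷ rec ys
    ... | tri> _ _ _ = y ∷ merge-into x xs rec ys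

  _∖_ : List Var → List Var → List Var
  ys ∖ xs = filter (λ y → ¬? (y ∈? xs)) ys

  _⊆_ : List Var → List Var → Set
  xs ⊆ ys = ∀ {x} → x ∈ xs → x ∈ ys

  Disjoint : List Var → List Var → Set
  Disjoint xs ys = ∀ {x} → x ∈ xs → x ∉ ys

record StrictMarkov (o ℓ : Level) : Set (suc (o ⊔ ℓ)) where
  infixr 9 _∘_
  infixr 10 _⊗₀_ _⊗₁_
  field
    Obj : Set o
    Hom : Obj → Obj → Set ℓ
    id  : ∀ {A} → Hom A A
    _∘_ : ∀ {A B C} → Hom B C → Hom A B → Hom A C
    identityˡ : ∀ {A B} {f : Hom A B} → id ∘ f ≡ f
    identityʳ : ∀ {A B} {f : Hom A B} → f ∘ id ≡ f
    assoc : ∀ {A B C D} {f : Hom A B} {g : Hom B C} {h : Hom C D} →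
            (h ∘ g) ∘ f ≡ h ∘ (g ∘ f)

    _⊗₀_ : Obj → Obj → Obj
    I    : Obj
    _⊗₁_ : ∀ {A B C D} → Hom A B → Hom C D → Hom (A ⊗₀ C) (B ⊗₀ D)
    ⊗-id : ∀ {A B} → id {A} ⊗₁ id {B} ≡ id
    ⊗-∘  : ∀ {A B C D E F} {f : Hom B C} {g : Hom A B} {h : Hom E F} {k : Hom D E} →
           (f ∘ g) ⊗₁ (h ∘ k) ≡ (f ⊗₁ h) ∘ (g ⊗₁ k)
    assoc₀  : ∀ {A B C} → (A ⊗₀ B) ⊗₀ C ≡ A ⊗₀ (B ⊗₀ C)
    unitˡ₀  : ∀ {A} → I ⊗₀ A ≡ A
    unitʳ₀  : ∀ {A} → A ⊗₀ I ≡ A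
    assoc₁  : ∀ {A B C D E F} {f : Hom A B} {g : Hom C D} {h : Hom E F} →
              subst₂ Hom assoc₀ assoc₀ ((f ⊗₁ g) ⊗₁ h) ≡ f ⊗₁ (g ⊗₁ h)
    unitˡ₁  : ∀ {A B} {f : Hom A B} → subst₂ Hom unitˡ₀ unitˡ₀ (id {I} ⊗₁ f) ≡ f
    unitʳ₁  : ∀ {A B} {f : Hom A B} → subst₂ Hom unitʳ₀ unitʳ₀ (f ⊗₁ id {I}) ≡ f

    σ     : ∀ {A B} → Hom (A ⊗₀ B) (B ⊗₀ A)
    σ-nat : ∀ {A B C D} {f : Hom A B} {g : Hom C D} → σ ∘ (f ⊗₁ g) ≡ (g ⊗₁ f) ∘ σ
    σ-inv : ∀ {A B} → σ {B} {A} ∘ σ {A} {B} ≡ id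
    hexagon : ∀ {A B C} →
      σ {A} {B ⊗₀ C} ≡ subst₂ Hom Eq.refl (Eq.sym assoc₀) (id {B} ⊗₁ σ {A} {C})
                       ∘ subst₂ Hom assoc₀ assoc₀ (σ {A} {B} ⊗₁ id {C})

    copy : ∀ {A} → Hom A (A ⊗₀ A)
    del  : ∀ {A} → Hom A I
    copy-unitˡ : ∀ {A} → subst₂ Hom Eq.refl unitˡ₀ ((del ⊗₁ id) ∘ copy {A}) ≡ id
    copy-unitʳ : ∀ {A} → subst₂ Hom Eq.refl unitʳ₀ ((id ⊗₁ del) ∘ copy {A}) ≡ id
    copy-assoc : ∀ {A} → subst₂ Hom Eq.refl assoc₀ ((copy ⊗₁ id) ∘ copy {A})
                         ≡ (id ⊗₁ copy) ∘ copy {A}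
    copy-comm  : ∀ {A} → σ ∘ copy {A} ≡ copy
    copy-⊗ : ∀ {A B} →
      copy {A ⊗₀ B} ≡
        subst₂ Hom Eq.refl (Eq.trans (cong (A ⊗₀_) assoc₀) (Eq.sym assoc₀))
               (id {A} ⊗₁ (σ {A} {B} ⊗₁ id {B}))
        ∘ subst₂ Hom Eq.refl (Eq.trans assoc₀ (cong (A ⊗₀_) (Eq.sym assoc₀)))
               (copy {A} ⊗₁ copy {B})
    copy-I : copy {I} ≡ subst₂ Hom Eq.refl (Eq.sym unitˡ₀) id
    del-⊗  : ∀ {A B} → del {A ⊗₀ B} ≡ subst₂ Hom Eq.refl unitˡ₀ (del {A} ⊗₁ del {B})
    del-I  : del {I} ≡ id
    del-nat : ∀ {A B} {f : Hom A B} → del ∘ f ≡ del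

module _ {o ℓ} (𝕍 : VarStructure) (ℂ : StrictMarkov o ℓ) where
  open VarStructure 𝕍
  open StrictMarkov ℂ

  module _ (θ : Var → Obj) where

    ⟦_⟧ : List Var → Obj
    ⟦_⟧ = foldr (λ x A → θ x ⊗₀ A) I

    ⟦++⟧ : ∀ xs ys → ⟦ xs ++ ys ⟧ ≡ ⟦ xs ⟧ ⊗₀ ⟦ ys ⟧
    ⟦++⟧ [] ys = Eq.sym unitˡ₀
    ⟦++⟧ (x ∷ xs) ys = Eq.trans (cong (θ x ⊗₀_) (⟦++⟧ xs ys)) (Eq.sym assoc₀)

    Homθ : List Var → List Var → Set ℓ
    Homθ xs ys = Hom ⟦ xs ⟧ ⟦ ys ⟧

    _⊗θ_ : ∀ {xs ys us vs} → Homθ xs ys → Homθ us vs → Homθ (xs ++ us) (ys ++ vs)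
    _⊗θ_ {xs} {ys} {us} {vs} f g =
      subst₂ Hom (Eq.sym (⟦++⟧ xs us)) (Eq.sym (⟦++⟧ ys vs)) (f ⊗₁ g)

    copyθ : ∀ xs → Homθ xs (xs ++ xs)
    copyθ xs = subst₂ Hom Eq.refl (Eq.sym (⟦++⟧ xs xs)) copy

    permMor : ∀ {xs ys} → xs ↭ ys → Homθ xs ys
    permMor refl = id
    permMor (prep x p) = id {θ x} ⊗₁ permMor p
    permMor (swap x y p) = subst₂ Hom assoc₀ assoc₀ (σ {θ x} {θ y} ⊗₁ permMor p)
    permMor (trans p q) = permMor q ∘ permMor p

    Rewiring : ∀ xs ys → Homθ xs ys → Set (ℓ ⊔ 0ℓ)
    Rewiring xs ys s = Σ[ p ∈ xs ↭ ys ] s ≡ permMor p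

    IsKernel : ∀ X Y → Homθ X Y → Set ℓ
    IsKernel X Y f =
      X ⊆ Y ×
      Σ[ f′ ∈ Homθ X (Y ∖ X) ] Σ[ s ∈ Homθ (X ++ (Y ∖ X)) Y ]
        (Rewiring (X ++ (Y ∖ X)) Y s × f ≡ s ∘ (_⊗θ_ {X} {X} {X} {Y ∖ X} (id {⟦ X ⟧}) f′) ∘ copyθ X)

    record Kernel : Set ℓ where
      field
        dom     : List Var
        cod     : List Var
        dom-set : Sorted dom
        cod-set : Sorted cod
        mor     : Homθ dom cod
        kernel  : IsKernel dom cod mor
    open Kernel public

    _⊑_ : Kernel → Kernel → Set ℓ
    f ⊑ g =
      Σ[ Z ∈ List Var ] Sorted Z × Disjoint Z (cod f) ×
      Σ[ h ∈ Homθ (cod f ∪ Z) (cod g) ] IsKernel (cod f ∪ Z) (cod g) h ×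
      Σ[ s₁ ∈ Homθ (dom f ∪ Z) (dom f ++ Z) ] Rewiring (dom f ∪ Z) (dom f ++ Z) s₁ ×
      Σ[ s₂ ∈ Homθ (cod f ++ Z) (cod f ∪ Z) ] Rewiring (cod f ++ Z) (cod f ∪ Z) s₂ ×
      Σ[ e ∈ dom g ≡ dom f ∪ Z ]
        subst (λ W → Homθ W (cod g)) e (mor g) ≡ h ∘ s₂ ∘ (_⊗θ_ {dom f} {cod f} {Z} {Z} (mor f) (id {⟦ Z ⟧})) ∘ s₁

-- A kernel is r ∘ (id ⊗ c) ∘ copy for a rewiring r and c producing the fresh variables Y ∖ X; allowing any
-- list of fresh variables gives "rewired graphs". Rewirings are built from symmetries, hence deterministic
-- (copy commutes with them), so rewired graphs are closed under composition and under tensoring with an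
-- identity. Reflexivity takes Z = ∅. For transitivity, substituting g = h₁ ∘ s₂ ∘ (f ⊗ id) ∘ s₁ into
-- k = h₂ ∘ t₂ ∘ (g ⊗ id) ∘ t₁ and identifying (f ⊗ id_Z₁) ⊗ id_Z₂ with f ⊗ id_(Z₁ ∪ Z₂) up to rewiring
-- factors k through f ⊗ id_(Z₁ ∪ Z₂), with a rewired graph behind it.

module Submission where

open import Level using (Level; _⊔_; 0ℓ)
open import Data.Product using (Σ; Σ-syntax; _×_; _,_; proj₁; proj₂)
open import Data.Sum using (_⊎_; inj₁; inj₂; [_,_])
open import Data.List using (List; []; _∷_; _++_)
import Data.List.Properties as List
open import Data.List.Relation.Unary.Any using (here; there)
open import Data.List.Relation.Unary.All as All using (All; _∷_)
open import Data.List.Relation.Unary.AllPairs as AllPairs using (AllPairs; _∷_)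
import Data.List.Relation.Unary.Linked as Linked
import Data.List.Relation.Unary.Linked.Properties as Linkedₚ
open import Data.List.Membership.Propositional using (_∈_)
import Data.List.Membership.Propositional.Properties as ∈
open import Data.List.Membership.Propositional.Properties.WithK using (unique∧set⇒bag)
import Data.List.Membership.DecPropositional as DecMembership
open import Data.List.Relation.Unary.Unique.Propositional using (Unique)
import Data.List.Relation.Unary.Unique.Propositional.Properties as Unique
open import Data.List.Relation.Binary.BagAndSetEquality using (∼bag⇒↭)
open import Data.List.Relation.Binary.Equality.Propositional using (≋⇒≡)
open import Data.List.Relation.Binary.Permutation.Propositional as ↭
  using (_↭_; ↭-sym; ↭-reflexive; ↭⇒↭ₛ′)
import Data.List.Relation.Binary.Permutation.Propositional.Properties as Perm
import Data.List.Relation.Unary.Sorted.TotalOrder.Properties as SortedTotalOrder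
open import Relation.Binary.Bundles using (TotalOrder)
import Relation.Binary.Construct.StrictToNonStrict as StrictToNonStrict
open import Relation.Binary.Definitions using (tri<; tri≈; tri>)
open import Relation.Binary.Structures using (IsStrictTotalOrder)
open import Relation.Binary.PropositionalEquality
  using (_≡_; refl; sym; trans; cong; cong₂; subst; subst₂; isEquivalence; module ≡-Reasoning)
open import Relation.Nullary using (yes; no)
open import Relation.Nullary.Decidable using (¬?)
open import Function.Bundles using (mk⇔)

open import Defs

-- ⊗ is strict only up to propositional equalities of objects (assoc₀, unitˡ₀, ⟦++⟧, …), so morphisms are
-- compared across such equalities.
module Transport {o ℓ} (ℂ : StrictMarkov o ℓ) where
  open StrictMarkov ℂ

  infix 4 _≈_
  _≈_ : ∀ {A B A′ B′} → Hom A B → Hom A′ B′ → Set (o ⊔ ℓ)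
  _≈_ {A} {B} {A′} {B′} f g = Σ (A ≡ A′) λ p → Σ (B ≡ B′) λ q → subst₂ Hom p q f ≡ g

  ≈-refl : ∀ {A B} {f : Hom A B} → f ≈ f
  ≈-refl = refl , refl , refl

  ≈-sym : ∀ {A B A′ B′} {f : Hom A B} {g : Hom A′ B′} → f ≈ g → g ≈ f
  ≈-sym (refl , refl , refl) = ≈-refl

  ≈-trans : ∀ {A B A′ B′ A″ B″} {f : Hom A B} {g : Hom A′ B′} {h : Hom A″ B″} →
            f ≈ g → g ≈ h → f ≈ h
  ≈-trans (refl , refl , refl) (refl , refl , refl) = ≈-refl

  ≈⇒≡ : ∀ {A B} {f g : Hom A B} → f ≈ g → f ≡ g
  ≈⇒≡ (refl , refl , e) = e

  ≡⇒≈ : ∀ {A B} {f g : Hom A B} → f ≡ g → f ≈ g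
  ≡⇒≈ e = refl , refl , e

  subst₂-≈ : ∀ {A B A′ B′} (p : A ≡ A′) (q : B ≡ B′) (f : Hom A B) → subst₂ Hom p q f ≈ f
  subst₂-≈ refl refl f = ≈-refl

  ∘-resp-≈ : ∀ {A B C A′ B′ C′} {f : Hom A B} {g : Hom B C} {f′ : Hom A′ B′} {g′ : Hom B′ C′} →
             g ≈ g′ → f ≈ f′ → g ∘ f ≈ g′ ∘ f′
  ∘-resp-≈ (refl , refl , refl) (refl , refl , refl) = ≈-refl

  ⊗-resp-≈ : ∀ {A B C D A′ B′ C′ D′} {f : Hom A B} {g : Hom C D} {f′ : Hom A′ B′} {g′ : Hom C′ D′} →
             f ≈ f′ → g ≈ g′ → f ⊗₁ g ≈ f′ ⊗₁ g′
  ⊗-resp-≈ (refl , refl , refl) (refl , refl , refl) = ≈-refl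

  id-≈ : ∀ {A B} → A ≡ B → id {A} ≈ id {B}
  id-≈ refl = ≈-refl

  σ-≈ : ∀ {A B A′ B′} → A ≡ A′ → B ≡ B′ → σ {A} {B} ≈ σ {A′} {B′}
  σ-≈ refl refl = ≈-refl

  copy-≈ : ∀ {A A′} → A ≡ A′ → copy {A} ≈ copy {A′}
  copy-≈ refl = ≈-refl

  module ≈-Reasoning where
    infix 1 begin_
    infixr 2 _≈⟨_⟩_ _≡⟨_⟩_
    infix 3 _∎
    begin_ : ∀ {A B A′ B′} {f : Hom A B} {g : Hom A′ B′} → f ≈ g → f ≈ g
    begin p = p
    _≈⟨_⟩_ : ∀ {A B A′ B′ A″ B″} (f : Hom A B) {g : Hom A′ B′} {h : Hom A″ B″} →
             f ≈ g → g ≈ h → f ≈ h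
    f ≈⟨ p ⟩ q = ≈-trans p q
    _≡⟨_⟩_ : ∀ {A B A″ B″} (f : Hom A B) {g : Hom A B} {h : Hom A″ B″} → f ≡ g → g ≈ h → f ≈ h
    f ≡⟨ p ⟩ q = ≈-trans (≡⇒≈ p) q
    _∎ : ∀ {A B} (f : Hom A B) → f ≈ f
    f ∎ = ≈-refl

  elimˡ : ∀ {A B C X} {f : Hom A B} {g : Hom B C} → g ≈ id {X} → g ∘ f ≈ f
  elimˡ (refl , refl , refl) = refl , refl , identityˡ

  elimʳ : ∀ {A B C X} {f : Hom A B} {g : Hom B C} → f ≈ id {X} → g ∘ f ≈ g
  elimʳ (refl , refl , refl) = refl , refl , identityʳ

  cast : ∀ {A B} → A ≡ B → Hom A B
  cast {A} p = subst (Hom A) p id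

  cast-refl : ∀ {A} (p : A ≡ A) → cast p ≡ id
  cast-refl refl = refl

  cast-∘-cast : ∀ {A B C} (p : B ≡ C) (q : A ≡ B) → cast p ∘ cast q ≡ cast (trans q p)
  cast-∘-cast refl refl = identityˡ

  cast-elimˡ : ∀ {A B B′} (p : B ≡ B′) {f : Hom A B} → cast p ∘ f ≈ f
  cast-elimˡ refl = refl , refl , identityˡ

  cast-elimʳ : ∀ {A A′ B} (p : A′ ≡ A) {f : Hom A B} → f ∘ cast p ≈ f
  cast-elimʳ refl = refl , refl , identityʳ

  subst₂-cod-cast : ∀ {A B B′} (q : B ≡ B′) (f : Hom A B) → subst₂ Hom refl q f ≡ cast q ∘ f
  subst₂-cod-cast refl f = sym identityˡ

  subst₂-cast : ∀ {A B A′ B′} (p : A ≡ A′) (q : B ≡ B′) (f : Hom A B) →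
                subst₂ Hom p q f ≡ cast q ∘ f ∘ cast (sym p)
  subst₂-cast refl refl f = sym (trans identityˡ identityʳ)

  ∘-cast-resp-≈ : ∀ {A B B₁ C A′ B′ B₁′ C′} (p : B ≡ B₁) (p′ : B′ ≡ B₁′)
                  {f : Hom A B} {g : Hom B₁ C} {f′ : Hom A′ B′} {g′ : Hom B₁′ C′} →
                  g ≈ g′ → f ≈ f′ → g ∘ cast p ∘ f ≈ g′ ∘ cast p′ ∘ f′
  ∘-cast-resp-≈ refl refl (refl , refl , refl) (refl , refl , refl) = ≈-refl

  ∘-resp-≈-castˡ : ∀ {A B B₁ C A′ B′ C′} (p : B ≡ B₁)
                   {f : Hom A B} {g : Hom B₁ C} {f′ : Hom A′ B′} {g′ : Hom B′ C′} →
                   g ≈ g′ → f ≈ f′ → g ∘ cast p ∘ f ≈ g′ ∘ f′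
  ∘-resp-≈-castˡ refl (refl , refl , refl) (refl , refl , refl) = refl , refl , cong (_ ∘_) identityˡ

  ∘-resp-≈-castʳ : ∀ {A B C A′ B′ B₁′ C′} (p : B′ ≡ B₁′)
                   {f : Hom A B} {g : Hom B C} {f′ : Hom A′ B′} {g′ : Hom B₁′ C′} →
                   g ≈ g′ → f ≈ f′ → g ∘ f ≈ g′ ∘ cast p ∘ f′
  ∘-resp-≈-castʳ p eg ef = ≈-sym (∘-resp-≈-castˡ p (≈-sym eg) (≈-sym ef))

  cast-elimᵐ : ∀ {A B B₁ C X} (p : B ≡ B₁) {f : Hom A B} {g : Hom B₁ C} → g ≈ id {X} → g ∘ cast p ∘ f ≈ f
  cast-elimᵐ refl (refl , refl , refl) = refl , refl , trans identityˡ identityˡ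

module MonoidalFacts {o ℓ} (ℂ : StrictMarkov o ℓ) where
  open StrictMarkov ℂ
  open Transport ℂ

  ⊗-assoc-≈ : ∀ {A B C D E F} {f : Hom A B} {g : Hom C D} {h : Hom E F} →
              (f ⊗₁ g) ⊗₁ h ≈ f ⊗₁ (g ⊗₁ h)
  ⊗-assoc-≈ = assoc₀ , assoc₀ , assoc₁

  ⊗-unitˡ-≈ : ∀ {A B} {f : Hom A B} → id {I} ⊗₁ f ≈ f
  ⊗-unitˡ-≈ = unitˡ₀ , unitˡ₀ , unitˡ₁

  ⊗-unitʳ-≈ : ∀ {A B} {f : Hom A B} → f ⊗₁ id {I} ≈ f
  ⊗-unitʳ-≈ = unitʳ₀ , unitʳ₀ , unitʳ₁

  ⊗-interchange : ∀ {A B C D E F} {f : Hom B C} {g : Hom A B} {h : Hom E F} {k : Hom D E} →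
                  (f ⊗₁ h) ∘ (g ⊗₁ k) ≡ (f ∘ g) ⊗₁ (h ∘ k)
  ⊗-interchange = sym ⊗-∘

  id⊗-∘ : ∀ {X A B C} {f : Hom A B} {g : Hom B C} → id {X} ⊗₁ (g ∘ f) ≡ (id ⊗₁ g) ∘ (id ⊗₁ f)
  id⊗-∘ = trans (cong (_⊗₁ _) (sym identityˡ)) ⊗-∘

  ∘-⊗id : ∀ {X A B C} {f : Hom A B} {g : Hom B C} → (g ∘ f) ⊗₁ id {X} ≡ (g ⊗₁ id) ∘ (f ⊗₁ id)
  ∘-⊗id = trans (cong (_ ⊗₁_) (sym identityˡ)) ⊗-∘

  ⊗-slide : ∀ {A B C D} {f : Hom A B} {g : Hom C D} → (f ⊗₁ id) ∘ (id ⊗₁ g) ≡ (id ⊗₁ g) ∘ (f ⊗₁ id)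
  ⊗-slide = trans ⊗-interchange
              (trans (cong₂ _⊗₁_ (trans identityʳ (sym identityˡ)) (trans identityˡ (sym identityʳ)))
                     (sym ⊗-interchange))

  id⊗cast : ∀ {X B B′} (p : B ≡ B′) → id {X} ⊗₁ cast p ≡ cast (cong (X ⊗₀_) p)
  id⊗cast refl = ⊗-id

  ∘-cast-⊗id : ∀ {A B B′ C D} (p : B ≡ B′) (p′ : B ⊗₀ D ≡ B′ ⊗₀ D) {f : Hom A B} {g : Hom B′ C} →
               (g ∘ cast p ∘ f) ⊗₁ id {D} ≈ (g ⊗₁ id) ∘ cast p′ ∘ (f ⊗₁ id)
  ∘-cast-⊗id refl refl = ≡⇒≈ (trans (cong₂ _⊗₁_ (cong (_ ∘_) identityˡ) (sym identityˡ))
                               (trans ⊗-∘ (cong (_ ∘_) (sym identityˡ))))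

  id⊗-∘-cast : ∀ {A B B′ C D} (p : B ≡ B′) (p′ : D ⊗₀ B ≡ D ⊗₀ B′) {f : Hom A B} {g : Hom B′ C} →
               id {D} ⊗₁ (g ∘ cast p ∘ f) ≈ (id ⊗₁ g) ∘ cast p′ ∘ (id ⊗₁ f)
  id⊗-∘-cast refl refl = ≡⇒≈ (trans (cong₂ _⊗₁_ (sym identityˡ) (cong (_ ∘_) identityˡ))
                               (trans ⊗-∘ (cong (_ ∘_) (sym identityˡ))))

  copy-unitʳ-≈ : ∀ {A} → (id ⊗₁ del) ∘ copy {A} ≈ id {A}
  copy-unitʳ-≈ = refl , unitʳ₀ , copy-unitʳ

  copy-assoc-≈ : ∀ {A} → (copy ⊗₁ id) ∘ copy {A} ≈ (id ⊗₁ copy) ∘ copy {A}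
  copy-assoc-≈ = refl , assoc₀ , copy-assoc

  σ-⊗ʳ : ∀ {A B C} → σ {A} {B ⊗₀ C} ≈ (id {B} ⊗₁ σ {A} {C}) ∘ cast assoc₀ ∘ (σ {A} {B} ⊗₁ id {C})
  σ-⊗ʳ {A} {B} {C} =
    begin σ ≡⟨ hexagon ⟩
    subst₂ Hom refl (sym assoc₀) (id ⊗₁ σ) ∘ subst₂ Hom assoc₀ assoc₀ (σ ⊗₁ id)
      ≈⟨ ∘-resp-≈ (subst₂-≈ refl (sym assoc₀) _) (≡⇒≈ (subst₂-cast assoc₀ assoc₀ _)) ⟩
    (id ⊗₁ σ) ∘ (cast assoc₀ ∘ (σ ⊗₁ id) ∘ cast (sym assoc₀))
      ≈⟨ ∘-resp-≈ ≈-refl (≡⇒≈ (sym assoc)) ⟩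
    (id ⊗₁ σ) ∘ ((cast assoc₀ ∘ (σ ⊗₁ id)) ∘ cast (sym assoc₀))
      ≈⟨ ∘-resp-≈ ≈-refl (cast-elimʳ (sym assoc₀)) ⟩
    (id ⊗₁ σ) ∘ cast assoc₀ ∘ (σ ⊗₁ id) ∎
    where open ≈-Reasoning

  -- The other hexagon, obtained from the first by inverting both sides.
  σ-⊗ˡ : ∀ {A B C} → σ {A ⊗₀ B} {C} ≈ (σ {A} {C} ⊗₁ id {B}) ∘ cast (sym assoc₀) ∘ (id {A} ⊗₁ σ {B} {C})
  σ-⊗ˡ {A} {B} {C} =
    begin σ {A ⊗₀ B} {C}                     ≡⟨ sym identityˡ ⟩
    id ∘ σ                                   ≈⟨ ∘-resp-≈ (≈-sym T∘σ≈id) ≈-refl ⟩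
    (T ∘ cast assoc₀ ∘ σ {C} {A ⊗₀ B}) ∘ σ   ≡⟨ trans assoc (cong (T ∘_) (trans assoc
                                                  (trans (cong (cast assoc₀ ∘_) σ-inv) identityʳ))) ⟩
    T ∘ cast assoc₀                          ≈⟨ cast-elimʳ assoc₀ ⟩
    T ∎
    where
    open ≈-Reasoning
    T = (σ {A} {C} ⊗₁ id {B}) ∘ cast (sym assoc₀) ∘ (id {A} ⊗₁ σ {B} {C})
    σ⊗id-inv : ∀ {X Y Z} → (σ {Y} {X} ⊗₁ id {Z}) ∘ (σ ⊗₁ id) ≡ id
    σ⊗id-inv = trans ⊗-interchange (trans (cong₂ _⊗₁_ σ-inv identityˡ) ⊗-id)
    id⊗σ-inv : ∀ {X Y Z} → (id {X} ⊗₁ σ {Z} {Y}) ∘ (id ⊗₁ σ) ≡ id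
    id⊗σ-inv = trans ⊗-interchange (trans (cong₂ _⊗₁_ identityˡ σ-inv) ⊗-id)
    T∘σ≈id : T ∘ cast assoc₀ ∘ σ {C} {A ⊗₀ B} ≈ id {C ⊗₀ (A ⊗₀ B)}
    T∘σ≈id = begin
      T ∘ cast assoc₀ ∘ σ
        ≈⟨ ∘-cast-resp-≈ assoc₀ refl ≈-refl σ-⊗ʳ ⟩
      T ∘ cast refl ∘ ((id ⊗₁ σ) ∘ cast assoc₀ ∘ (σ ⊗₁ id))
        ≡⟨ trans (cong (T ∘_) identityˡ) (trans assoc (cong ((σ ⊗₁ id) ∘_) assoc)) ⟩
      (σ ⊗₁ id) ∘ cast (sym assoc₀) ∘ ((id ⊗₁ σ) ∘ ((id ⊗₁ σ) ∘ cast assoc₀ ∘ (σ ⊗₁ id)))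
        ≡⟨ cong (λ z → (σ ⊗₁ id) ∘ cast (sym assoc₀) ∘ z)
             (trans (sym assoc) (trans (cong (_∘ (cast assoc₀ ∘ (σ ⊗₁ id))) id⊗σ-inv) identityˡ)) ⟩
      (σ ⊗₁ id) ∘ cast (sym assoc₀) ∘ cast assoc₀ ∘ (σ ⊗₁ id)
        ≡⟨ cong ((σ ⊗₁ id) ∘_) (trans (sym assoc)
             (trans (cong (_∘ (σ ⊗₁ id)) (trans (cast-∘-cast (sym assoc₀) assoc₀) (cast-refl _))) identityˡ)) ⟩
      (σ ⊗₁ id) ∘ (σ ⊗₁ id)
        ≡⟨ σ⊗id-inv ⟩
      id ≈⟨ id-≈ assoc₀ ⟩
      id ∎

  -- The hexagon with B = C = I makes σ {A} {I} idempotent; being invertible, it is the identity.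
  σ-unitʳ : ∀ {A} → σ {A} {I} ≈ id {A}
  σ-unitʳ {A} = ≈-trans (≈-sym (cast-elimˡ r)) (≈-trans (≡⇒≈ cast∘σ≡id) (id-≈ unitʳ₀))
    where
    r : I ⊗₀ A ≡ A ⊗₀ I
    r = trans unitˡ₀ (sym unitʳ₀)
    σ≈σ∘σ : σ {A} {I} ≈ σ {A} {I} ∘ cast r ∘ σ {A} {I}
    σ≈σ∘σ = begin
      σ {A} {I}                        ≈⟨ σ-≈ refl (sym unitˡ₀) ⟩
      σ {A} {I ⊗₀ I}                   ≈⟨ σ-⊗ʳ ⟩
      (id ⊗₁ σ) ∘ cast assoc₀ ∘ (σ ⊗₁ id) ≈⟨ ∘-cast-resp-≈ assoc₀ r ⊗-unitˡ-≈ ⊗-unitʳ-≈ ⟩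
      σ ∘ cast r ∘ σ ∎
      where open ≈-Reasoning
    cast∘σ≡id : cast r ∘ σ {A} {I} ≡ id
    cast∘σ≡id = begin
      cast r ∘ σ                  ≡⟨ sym identityˡ ⟩
      id ∘ cast r ∘ σ             ≡⟨ cong (_∘ (cast r ∘ σ)) (sym σ-inv) ⟩
      (σ ∘ σ) ∘ cast r ∘ σ        ≡⟨ trans assoc (cong (σ ∘_) (sym (≈⇒≡ σ≈σ∘σ))) ⟩
      σ ∘ σ                       ≡⟨ σ-inv ⟩
      id ∎
      where open ≡-Reasoning

  σ-unitˡ : ∀ {A} → σ {I} {A} ≈ id {A}
  σ-unitˡ {A} = ≈-trans (≈-sym (elimʳ {g = σ {I} {A}} σ-unitʳ)) (≈-trans (≡⇒≈ σ-inv) (id-≈ unitʳ₀))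

module MarkovFacts {o ℓ} (ℂ : StrictMarkov o ℓ) where
  open StrictMarkov ℂ
  open Transport ℂ
  open MonoidalFacts ℂ

  ⊗-reassoc₄ : ∀ {A B C D A′ B′ C′ D′} {f : Hom A A′} {g : Hom B B′} {h : Hom C C′} {k : Hom D D′} →
               (f ⊗₁ g) ⊗₁ (h ⊗₁ k) ≈ f ⊗₁ ((g ⊗₁ h) ⊗₁ k)
  ⊗-reassoc₄ = ≈-trans ⊗-assoc-≈ (⊗-resp-≈ ≈-refl (≈-sym ⊗-assoc-≈))

  module _ {A A′ B B′ : Obj} where
    exchange-cod : A ⊗₀ ((B ⊗₀ A′) ⊗₀ B′) ≡ (A ⊗₀ B) ⊗₀ (A′ ⊗₀ B′)
    exchange-cod = trans (cong (A ⊗₀_) assoc₀) (sym assoc₀)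

    exchange-dom : (A ⊗₀ A′) ⊗₀ (B ⊗₀ B′) ≡ A ⊗₀ ((A′ ⊗₀ B) ⊗₀ B′)
    exchange-dom = trans assoc₀ (cong (A ⊗₀_) (sym assoc₀))

    -- The middle-four interchange, as it appears in the axiom copy-⊗.
    exchange : Hom ((A ⊗₀ A′) ⊗₀ (B ⊗₀ B′)) ((A ⊗₀ B) ⊗₀ (A′ ⊗₀ B′))
    exchange = cast exchange-cod ∘ (id {A} ⊗₁ (σ {A′} {B} ⊗₁ id {B′})) ∘ cast exchange-dom

    exchange-≈ : exchange ≈ id {A} ⊗₁ (σ {A′} {B} ⊗₁ id {B′})
    exchange-≈ = ≈-trans (cast-elimˡ _) (cast-elimʳ _)

  copy-⊗-exchange : ∀ {A B} → copy {A ⊗₀ B} ≡ exchange ∘ (copy ⊗₁ copy)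
  copy-⊗-exchange = trans copy-⊗ (trans (cong₂ _∘_ (subst₂-cod-cast _ _) (subst₂-cod-cast _ _))
                      (trans assoc (trans (cong (cast _ ∘_) (sym assoc)) (sym assoc))))

  exchange-natural : ∀ {A A′ B B′ C C′ D D′} {f : Hom A C} {f′ : Hom A′ C′} {g : Hom B D} {g′ : Hom B′ D′} →
                     exchange ∘ ((f ⊗₁ f′) ⊗₁ (g ⊗₁ g′)) ≡ ((f ⊗₁ g) ⊗₁ (f′ ⊗₁ g′)) ∘ exchange
  exchange-natural {f = f} {f′} {g} {g′} = ≈⇒≡ (begin
    exchange ∘ ((f ⊗₁ f′) ⊗₁ (g ⊗₁ g′))         ≈⟨ ∘-resp-≈ exchange-≈ ⊗-reassoc₄ ⟩
    (id ⊗₁ (σ ⊗₁ id)) ∘ (f ⊗₁ ((f′ ⊗₁ g) ⊗₁ g′)) ≡⟨ trans ⊗-interchange (trans (cong₂ _⊗₁_ id-slide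
                                                     (trans ⊗-interchange (trans (cong₂ _⊗₁_ σ-nat id-slide)
                                                       (sym ⊗-interchange)))) (sym ⊗-interchange)) ⟩
    (f ⊗₁ ((g ⊗₁ f′) ⊗₁ g′)) ∘ (id ⊗₁ (σ ⊗₁ id)) ≈⟨ ∘-resp-≈ (≈-sym ⊗-reassoc₄) (≈-sym exchange-≈) ⟩
    ((f ⊗₁ g) ⊗₁ (f′ ⊗₁ g′)) ∘ exchange ∎)
    where
    open ≈-Reasoning
    id-slide : ∀ {X Y} {h : Hom X Y} → id ∘ h ≡ h ∘ id
    id-slide = trans identityˡ (sym identityʳ)

  -- Expanding σ by both hexagons gives four elementary symmetries; the one moving A past B′ cancels
  -- against exchange.
  exchange-σ : ∀ {A A′ B B′} →
               exchange ∘ σ {A ⊗₀ A′} {B ⊗₀ B′} ≈ (σ {A} {B} ⊗₁ σ {A′} {B′}) ∘ exchange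
  exchange-σ {A} {A′} {B} {B′} =
    ≈-trans (∘-resp-≈-castʳ assoc₀ ≈-refl σ-⊗ˡ)
    (≈-trans (∘-cast-resp-≈ assoc₀ r ≈-refl
               (∘-cast-resp-≈ (sym assoc₀) p (⊗-resp-≈ σ-⊗ʳ ≈-refl) (⊗-resp-≈ ≈-refl σ-⊗ʳ)))
    (≈-trans (∘-cast-resp-≈ r r ≈-refl (∘-cast-resp-≈ p p (∘-cast-⊗id assoc₀ (cong (_⊗₀ A′) assoc₀))
                                                          (id⊗-∘-cast assoc₀ (cong (A ⊗₀_) assoc₀))))
    (≈-trans (≡⇒≈ (trans (cong (λ z → exchange ∘ cast r ∘ z) (trans assoc (cong (X ∘_) assoc)))
                 (trans (cong (exchange ∘_) (sym assoc)) (sym assoc))))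
    (≈-trans (cast-elimᵐ (cong (_⊗₀ A′) assoc₀) exchange∘X≈id)
    (≈-trans (∘-cast-resp-≈ p refl σ⊗id≈ (∘-cast-resp-≈ (cong (A ⊗₀_) assoc₀) exchange-cod id⊗σ≈ ≈-refl))
    (≈-sym σ⊗σ∘exchange))))))
    where
    p : A ⊗₀ (B ⊗₀ (B′ ⊗₀ A′)) ≡ ((A ⊗₀ B) ⊗₀ B′) ⊗₀ A′
    p = trans (cong (A ⊗₀_) (sym assoc₀)) (trans (sym assoc₀) (cong (_⊗₀ A′) (sym assoc₀)))
    r : (B ⊗₀ (B′ ⊗₀ A)) ⊗₀ A′ ≡ (B ⊗₀ B′) ⊗₀ (A ⊗₀ A′)
    r = trans (cong (_⊗₀ A′) (sym assoc₀)) assoc₀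
    X = (id {B} ⊗₁ σ {A} {B′}) ⊗₁ id {A′}
    exchange∘X≈id : exchange ∘ cast r ∘ X ≈ id {B ⊗₀ ((A ⊗₀ B′) ⊗₀ A′)}
    exchange∘X≈id = ≈-trans (∘-resp-≈-castˡ r exchange-≈ ⊗-assoc-≈)
      (≡⇒≈ (trans ⊗-interchange (trans (cong₂ _⊗₁_ identityˡ
        (trans ⊗-interchange (trans (cong₂ _⊗₁_ σ-inv identityˡ) ⊗-id))) ⊗-id)))
    σ⊗id≈ : (σ {A} {B} ⊗₁ id {B′}) ⊗₁ id {A′} ≈ σ {A} {B} ⊗₁ id {B′ ⊗₀ A′}
    σ⊗id≈ = ≈-trans ⊗-assoc-≈ (⊗-resp-≈ ≈-refl (≡⇒≈ ⊗-id))
    id⊗σ≈ : id {A} ⊗₁ (id {B} ⊗₁ σ {A′} {B′}) ≈ id {A ⊗₀ B} ⊗₁ σ {A′} {B′}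
    id⊗σ≈ = ≈-trans (≈-sym ⊗-assoc-≈) (⊗-resp-≈ (≡⇒≈ ⊗-id) ≈-refl)
    σ⊗σ∘exchange : (σ {A} {B} ⊗₁ σ {A′} {B′}) ∘ exchange ≈
                   (σ ⊗₁ id) ∘ cast refl ∘ (id ⊗₁ σ) ∘ cast exchange-cod ∘ (id ⊗₁ (σ ⊗₁ id))
    σ⊗σ∘exchange =
      ≈-trans (≡⇒≈ (trans (cong (_∘ exchange) (trans (cong₂ _⊗₁_ (sym identityʳ) (sym identityˡ)) ⊗-∘))
                   (trans assoc (cong ((σ ⊗₁ id) ∘_) (sym identityˡ)))))
        (∘-resp-≈ ≈-refl (∘-resp-≈ ≈-refl (∘-resp-≈ ≈-refl (∘-resp-≈ ≈-refl (cast-elimʳ _)))))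

module Graphs {o ℓ} (ℂ : StrictMarkov o ℓ) where
  open StrictMarkov ℂ
  open Transport ℂ
  open MonoidalFacts ℂ
  open MarkovFacts ℂ

  Deterministic : ∀ {A B} → Hom A B → Set ℓ
  Deterministic f = copy ∘ f ≡ (f ⊗₁ f) ∘ copy

  deterministic-id : ∀ {A} → Deterministic (id {A})
  deterministic-id = trans identityʳ (sym (trans (cong (_∘ copy) ⊗-id) identityˡ))

  deterministic-∘ : ∀ {A B C} {f : Hom A B} {g : Hom B C} →
                    Deterministic f → Deterministic g → Deterministic (g ∘ f)
  deterministic-∘ {f = f} {g} df dg = begin
    copy ∘ g ∘ f           ≡⟨ trans (sym assoc) (cong (_∘ f) dg) ⟩
    ((g ⊗₁ g) ∘ copy) ∘ f  ≡⟨ trans assoc (cong ((g ⊗₁ g) ∘_) df) ⟩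
    (g ⊗₁ g) ∘ (f ⊗₁ f) ∘ copy ≡⟨ trans (sym assoc) (cong (_∘ copy) ⊗-interchange) ⟩
    ((g ∘ f) ⊗₁ (g ∘ f)) ∘ copy ∎
    where open ≡-Reasoning

  deterministic-cast : ∀ {A B} (p : A ≡ B) → Deterministic (cast p)
  deterministic-cast refl = deterministic-id

  deterministic-subst₂ : ∀ {A B A′ B′} (p : A ≡ A′) (q : B ≡ B′) {f : Hom A B} →
                         Deterministic f → Deterministic (subst₂ Hom p q f)
  deterministic-subst₂ refl refl d = d

  deterministic-⊗ : ∀ {A B C D} {f : Hom A B} {g : Hom C D} →
                    Deterministic f → Deterministic g → Deterministic (f ⊗₁ g)
  deterministic-⊗ {f = f} {g} df dg = begin
    copy ∘ (f ⊗₁ g)                                ≡⟨ cong (_∘ (f ⊗₁ g)) copy-⊗-exchange ⟩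
    (exchange ∘ (copy ⊗₁ copy)) ∘ (f ⊗₁ g)         ≡⟨ trans assoc (cong (exchange ∘_) ⊗-interchange) ⟩
    exchange ∘ ((copy ∘ f) ⊗₁ (copy ∘ g))
      ≡⟨ cong (exchange ∘_) (trans (cong₂ _⊗₁_ df dg) (sym ⊗-interchange)) ⟩
    exchange ∘ ((f ⊗₁ f) ⊗₁ (g ⊗₁ g)) ∘ (copy ⊗₁ copy)
      ≡⟨ trans (sym assoc) (cong (_∘ (copy ⊗₁ copy)) exchange-natural) ⟩
    (((f ⊗₁ g) ⊗₁ (f ⊗₁ g)) ∘ exchange) ∘ (copy ⊗₁ copy) ≡⟨ trans assoc (cong (_ ∘_) (sym copy-⊗-exchange)) ⟩
    ((f ⊗₁ g) ⊗₁ (f ⊗₁ g)) ∘ copy ∎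
    where open ≡-Reasoning

  deterministic-σ : ∀ {A B} → Deterministic (σ {A} {B})
  deterministic-σ = begin
    copy ∘ σ                              ≡⟨ cong (_∘ σ) copy-⊗-exchange ⟩
    (exchange ∘ (copy ⊗₁ copy)) ∘ σ       ≡⟨ trans assoc (cong (exchange ∘_) (sym σ-nat)) ⟩
    exchange ∘ σ ∘ (copy ⊗₁ copy)         ≡⟨ trans (sym assoc) (cong (_∘ (copy ⊗₁ copy)) (≈⇒≡ exchange-σ)) ⟩
    ((σ ⊗₁ σ) ∘ exchange) ∘ (copy ⊗₁ copy) ≡⟨ trans assoc (cong ((σ ⊗₁ σ) ∘_) (sym copy-⊗-exchange)) ⟩
    (σ ⊗₁ σ) ∘ copy ∎
    where open ≡-Reasoning

  graph : ∀ {X A} → Hom X A → Hom X (X ⊗₀ A)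
  graph a = (id ⊗₁ a) ∘ copy

  -- x ↦ (a x , x , a x)
  copyGraph-tail : ∀ {X A} → Hom X A → Hom X ((A ⊗₀ X) ⊗₀ A)
  copyGraph-tail {X} {A} a = (σ {X} {A} ⊗₁ id {A}) ∘ cast (sym assoc₀) ∘ graph (copy ∘ a)

  copy-graph : ∀ {X A} (a : Hom X A) → copy ∘ graph a ≈ graph (copyGraph-tail a)
  copy-graph {X} {A} a =
    ≈-trans expand (≈-trans (∘-cast-resp-≈ exchange-dom s ≈-refl copy³) (≡⇒≈ (sym tail-expand)))
    where
    ca = copy {A} ∘ a
    Y = id {X} ⊗₁ (σ {X} {A} ⊗₁ id {A})
    s : X ⊗₀ (X ⊗₀ (A ⊗₀ A)) ≡ X ⊗₀ ((X ⊗₀ A) ⊗₀ A)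
    s = cong (X ⊗₀_) (sym assoc₀)
    expand : copy ∘ graph a ≈ Y ∘ cast exchange-dom ∘ (copy ⊗₁ ca) ∘ copy
    expand = ≈-trans (≡⇒≈ (begin
      copy ∘ (id ⊗₁ a) ∘ copy
        ≡⟨ trans (cong (_∘ ((id ⊗₁ a) ∘ copy)) copy-⊗-exchange) assoc ⟩
      exchange ∘ (copy ⊗₁ copy) ∘ (id ⊗₁ a) ∘ copy ≡⟨ cong (exchange ∘_) (trans (sym assoc)
                                                       (cong (_∘ copy) (trans ⊗-interchange (cong (_⊗₁ ca) identityʳ)))) ⟩
      exchange ∘ (copy ⊗₁ ca) ∘ copy               ≡⟨ trans assoc (cong (cast exchange-cod ∘_) assoc) ⟩
      cast exchange-cod ∘ (Y ∘ cast exchange-dom ∘ (copy ⊗₁ ca) ∘ copy) ∎)) (cast-elimˡ _)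
      where open ≡-Reasoning
    copy³ : (copy ⊗₁ ca) ∘ copy ≈ (id {X} ⊗₁ (id {X} ⊗₁ ca)) ∘ (id ⊗₁ copy) ∘ copy {X}
    copy³ = ≈-trans (≡⇒≈ (trans (cong (λ z → (z ⊗₁ ca) ∘ copy) (sym (trans (cong (_∘ copy) ⊗-id) identityˡ)))
              (trans (cong (_∘ copy) (trans (cong (((id {X} ⊗₁ id {X}) ∘ copy {X}) ⊗₁_) (sym (identityʳ {f = ca})))
                                            ⊗-∘))
                     assoc)))
            (∘-resp-≈ ⊗-assoc-≈ copy-assoc-≈)
    tail-expand : graph (copyGraph-tail a) ≡ Y ∘ cast s ∘ (id ⊗₁ (id ⊗₁ ca)) ∘ (id ⊗₁ copy) ∘ copy
    tail-expand = begin
      (id ⊗₁ copyGraph-tail a) ∘ copy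
        ≡⟨ cong (_∘ copy) (trans id⊗-∘ (cong (Y ∘_) (trans id⊗-∘ (cong₂ _∘_ (id⊗cast (sym assoc₀)) id⊗-∘)))) ⟩
      (Y ∘ cast s ∘ (id ⊗₁ (id ⊗₁ ca)) ∘ (id ⊗₁ copy)) ∘ copy
        ≡⟨ trans assoc (cong (Y ∘_) (trans assoc (cong (cast s ∘_) assoc))) ⟩
      Y ∘ cast s ∘ (id ⊗₁ (id ⊗₁ ca)) ∘ (id ⊗₁ copy) ∘ copy ∎
      where open ≡-Reasoning

  graph-∘-deterministic-∘-graph :
    ∀ {X A Y B} (b : Hom Y B) (P : Hom (X ⊗₀ A) Y) (a : Hom X A) → Deterministic P →
    graph b ∘ P ∘ graph a ≈
      (P ⊗₁ id {B}) ∘ cast (sym assoc₀) ∘ graph ((id {A} ⊗₁ (b ∘ P)) ∘ cast assoc₀ ∘ copyGraph-tail a)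
  graph-∘-deterministic-∘-graph {X} {A} {Y} {B} b P a dP =
    ≈-trans (≡⇒≈ copy-past-P)
      (≈-trans (∘-resp-≈-castʳ r ≈-refl (copy-graph a))
        (≈-trans (∘-cast-resp-≈ r t P⊗bP≈ ≈-refl) (≡⇒≈ (sym regroup))))
    where
    r : X ⊗₀ ((A ⊗₀ X) ⊗₀ A) ≡ (X ⊗₀ A) ⊗₀ (X ⊗₀ A)
    r = trans (cong (X ⊗₀_) assoc₀) (sym assoc₀)
    t : X ⊗₀ ((A ⊗₀ X) ⊗₀ A) ≡ X ⊗₀ (A ⊗₀ (X ⊗₀ A))
    t = cong (X ⊗₀_) assoc₀
    U = id {X} ⊗₁ (id {A} ⊗₁ (b ∘ P))
    Q = (P ⊗₁ id {B}) ∘ cast (sym assoc₀) ∘ U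
    copy-past-P : graph b ∘ P ∘ graph a ≡ (P ⊗₁ (b ∘ P)) ∘ (copy ∘ graph a)
    copy-past-P = begin
      ((id ⊗₁ b) ∘ copy) ∘ P ∘ graph a
        ≡⟨ trans assoc (cong ((id ⊗₁ b) ∘_) (trans (sym assoc) (trans (cong (_∘ graph a) dP) assoc))) ⟩
      (id ⊗₁ b) ∘ (P ⊗₁ P) ∘ copy ∘ graph a
        ≡⟨ trans (sym assoc) (cong (_∘ (copy ∘ graph a)) (trans ⊗-interchange (cong (_⊗₁ (b ∘ P)) identityˡ))) ⟩
      (P ⊗₁ (b ∘ P)) ∘ (copy ∘ graph a) ∎
      where open ≡-Reasoning
    P⊗bP≈ : P ⊗₁ (b ∘ P) ≈ Q
    P⊗bP≈ = ≈-sym (≈-trans (∘-resp-≈-castˡ (sym assoc₀) ≈-refl (≈-sym ⊗-assoc-≈))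
              (≡⇒≈ (trans ⊗-interchange (cong₂ _⊗₁_ (trans (cong (P ∘_) ⊗-id) identityʳ) identityˡ))))
    regroup : (P ⊗₁ id) ∘ cast (sym assoc₀) ∘ graph ((id ⊗₁ (b ∘ P)) ∘ cast assoc₀ ∘ copyGraph-tail a)
              ≡ Q ∘ cast t ∘ graph (copyGraph-tail a)
    regroup = begin
      (P ⊗₁ id) ∘ cast (sym assoc₀) ∘ (id ⊗₁ ((id ⊗₁ (b ∘ P)) ∘ cast assoc₀ ∘ copyGraph-tail a)) ∘ copy
        ≡⟨ cong (λ z → (P ⊗₁ id) ∘ cast (sym assoc₀) ∘ z ∘ copy)
             (trans id⊗-∘ (cong (U ∘_) (trans id⊗-∘ (cong (_∘ (id ⊗₁ copyGraph-tail a)) (id⊗cast assoc₀))))) ⟩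
      (P ⊗₁ id) ∘ cast (sym assoc₀) ∘ (U ∘ cast t ∘ (id ⊗₁ copyGraph-tail a)) ∘ copy
        ≡⟨ cong (λ z → (P ⊗₁ id) ∘ cast (sym assoc₀) ∘ z) (trans assoc (cong (U ∘_) assoc)) ⟩
      (P ⊗₁ id) ∘ cast (sym assoc₀) ∘ U ∘ cast t ∘ graph (copyGraph-tail a)
        ≡⟨ sym (trans assoc (cong ((P ⊗₁ id) ∘_) assoc)) ⟩
      Q ∘ cast t ∘ graph (copyGraph-tail a) ∎
      where open ≡-Reasoning

  graph-⊗id : ∀ {X A Y W} (P : Hom (X ⊗₀ A) Y) (a : Hom X A) (s : (X ⊗₀ W) ⊗₀ (A ⊗₀ I) ≡ X ⊗₀ (W ⊗₀ A)) →
              (P ∘ graph a) ⊗₁ id {W} ≈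
              (P ⊗₁ id {W}) ∘ cast (sym assoc₀) ∘ (id {X} ⊗₁ σ {W} {A}) ∘ cast s ∘ graph (a ⊗₁ del {W})
  graph-⊗id {X} {A} {Y} {W} P a s =
    ≈-sym (≈-trans (≡⇒≈ (cong (λ z → (P ⊗₁ id {W}) ∘ cast (sym assoc₀) ∘ z) split))
      (≈-trans (∘-cast-resp-≈ (sym assoc₀) p ≈-refl (elimˡ N≈id))
      (≈-trans (∘-cast-resp-≈ p refl ≈-refl (⊗-resp-≈ ≈-refl copy-unitʳ-≈))
      (≡⇒≈ (trans (cong ((P ⊗₁ id) ∘_) identityˡ) (sym ∘-⊗id))))))
    where
    E = (id {W} ⊗₁ del {W}) ∘ copy {W}
    N = (id {X} ⊗₁ σ {W} {A}) ∘ cast s ∘ exchange {X} {A} {W} {I}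
    p : (X ⊗₀ A) ⊗₀ (W ⊗₀ I) ≡ (X ⊗₀ A) ⊗₀ W
    p = cong ((X ⊗₀ A) ⊗₀_) unitʳ₀
    N≈id : N ≈ id {X ⊗₀ (A ⊗₀ W)}
    N≈id = ≈-trans (∘-cast-resp-≈ s refl ≈-refl (≈-trans exchange-≈ (⊗-resp-≈ ≈-refl ⊗-unitʳ-≈)))
             (≡⇒≈ (trans (cong ((id ⊗₁ σ) ∘_) identityˡ) (trans (sym id⊗-∘) (trans (cong (id ⊗₁_) σ-inv) ⊗-id))))
    split : (id ⊗₁ σ) ∘ cast s ∘ graph (a ⊗₁ del) ≡ N ∘ (graph a ⊗₁ E)
    split = begin
      (id ⊗₁ σ) ∘ cast s ∘ (id ⊗₁ (a ⊗₁ del)) ∘ copy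
        ≡⟨ cong (λ z → (id ⊗₁ σ) ∘ cast s ∘ z) (begin
          (id ⊗₁ (a ⊗₁ del)) ∘ copy
            ≡⟨ cong₂ _∘_ (cong (_⊗₁ (a ⊗₁ del)) (sym ⊗-id)) copy-⊗-exchange ⟩
          ((id ⊗₁ id) ⊗₁ (a ⊗₁ del)) ∘ exchange ∘ (copy ⊗₁ copy)
            ≡⟨ trans (sym assoc) (cong (_∘ (copy ⊗₁ copy)) (sym exchange-natural)) ⟩
          (exchange ∘ ((id ⊗₁ a) ⊗₁ (id ⊗₁ del))) ∘ (copy ⊗₁ copy)
            ≡⟨ trans assoc (cong (exchange ∘_) ⊗-interchange) ⟩
          exchange ∘ (graph a ⊗₁ E) ∎) ⟩
      (id ⊗₁ σ) ∘ cast s ∘ exchange ∘ (graph a ⊗₁ E)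
        ≡⟨ sym (trans assoc (cong ((id ⊗₁ σ) ∘_) assoc)) ⟩
      N ∘ (graph a ⊗₁ E) ∎
      where open ≡-Reasoning

module FiniteSets (𝕍 : VarStructure) where
  open VarStructure 𝕍
  open IsStrictTotalOrder isSTO using (irrefl) renaming (trans to ≺-trans)
  open DecMembership _≟_ using (_∈?_)

  ∈-∪⁻ : ∀ xs ys {z} → z ∈ xs ∪ ys → z ∈ xs ⊎ z ∈ ys
  ∈-∪⁻ [] ys p = inj₂ p
  ∈-∪⁻ (x ∷ xs) [] p = inj₁ p
  ∈-∪⁻ (x ∷ xs) (y ∷ ys) p with compare x y
  ∈-∪⁻ (x ∷ xs) (y ∷ ys) (here e)  | tri< _ _ _ = inj₁ (here e)
  ∈-∪⁻ (x ∷ xs) (y ∷ ys) (there q) | tri< _ _ _ with ∈-∪⁻ xs (y ∷ ys) q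
  ... | inj₁ r = inj₁ (there r)
  ... | inj₂ r = inj₂ r
  ∈-∪⁻ (x ∷ xs) (y ∷ ys) (here e)  | tri≈ _ _ _ = inj₁ (here e)
  ∈-∪⁻ (x ∷ xs) (y ∷ ys) (there q) | tri≈ _ _ _ with ∈-∪⁻ xs ys q
  ... | inj₁ r = inj₁ (there r)
  ... | inj₂ r = inj₂ (there r)
  ∈-∪⁻ (x ∷ xs) (y ∷ ys) (here e)  | tri> _ _ _ = inj₂ (here e)
  ∈-∪⁻ (x ∷ xs) (y ∷ ys) (there q) | tri> _ _ _ with ∈-∪⁻ (x ∷ xs) ys q
  ... | inj₁ r = inj₁ r
  ... | inj₂ r = inj₂ (there r)

  ∈-∪⁺ˡ : ∀ xs ys {z} → z ∈ xs → z ∈ xs ∪ ys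
  ∈-∪⁺ˡ (x ∷ xs) [] p = p
  ∈-∪⁺ˡ (x ∷ xs) (y ∷ ys) p with compare x y
  ∈-∪⁺ˡ (x ∷ xs) (y ∷ ys) (here e)  | tri< _ _ _ = here e
  ∈-∪⁺ˡ (x ∷ xs) (y ∷ ys) (there q) | tri< _ _ _ = there (∈-∪⁺ˡ xs (y ∷ ys) q)
  ∈-∪⁺ˡ (x ∷ xs) (y ∷ ys) (here e)  | tri≈ _ _ _ = here e
  ∈-∪⁺ˡ (x ∷ xs) (y ∷ ys) (there q) | tri≈ _ _ _ = there (∈-∪⁺ˡ xs ys q)
  ∈-∪⁺ˡ (x ∷ xs) (y ∷ ys) p         | tri> _ _ _ = there (∈-∪⁺ˡ (x ∷ xs) ys p)

  ∈-∪⁺ʳ : ∀ xs ys {z} → z ∈ ys → z ∈ xs ∪ ys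
  ∈-∪⁺ʳ [] ys p = p
  ∈-∪⁺ʳ (x ∷ xs) (y ∷ ys) p with compare x y
  ∈-∪⁺ʳ (x ∷ xs) (y ∷ ys) p         | tri< _ _ _ = there (∈-∪⁺ʳ xs (y ∷ ys) p)
  ∈-∪⁺ʳ (x ∷ xs) (y ∷ ys) (here e)  | tri≈ _ x≡y _ = here (trans e (sym x≡y))
  ∈-∪⁺ʳ (x ∷ xs) (y ∷ ys) (there q) | tri≈ _ _ _ = there (∈-∪⁺ʳ xs ys q)
  ∈-∪⁺ʳ (x ∷ xs) (y ∷ ys) (here e)  | tri> _ _ _ = here e
  ∈-∪⁺ʳ (x ∷ xs) (y ∷ ys) (there q) | tri> _ _ _ = there (∈-∪⁺ʳ (x ∷ xs) ys q)

  ∪-identityʳ : ∀ xs → xs ∪ [] ≡ xs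
  ∪-identityʳ [] = refl
  ∪-identityʳ (x ∷ xs) = refl

  private
    Increasing : List Var → Set
    Increasing = AllPairs _≺_

    All≺-∪ : ∀ {v} xs ys → All (v ≺_) xs → All (v ≺_) ys → All (v ≺_) (xs ∪ ys)
    All≺-∪ xs ys ax ay = All.tabulate λ q → [ All.lookup ax , All.lookup ay ] (∈-∪⁻ xs ys q)

    All≺-∷ : ∀ {u v} xs → u ≺ v → All (v ≺_) xs → All (u ≺_) (v ∷ xs)
    All≺-∷ xs u≺v ax = u≺v ∷ All.map (≺-trans u≺v) ax

    ∪-increasing : ∀ xs ys → Increasing xs → Increasing ys → Increasing (xs ∪ ys)
    ∪-increasing-∷ : ∀ x xs ys → Increasing (x ∷ xs) → Increasing ys → Increasing ((x ∷ xs) ∪ ys)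
    ∪-increasing [] ys _ iy = iy
    ∪-increasing (x ∷ xs) ys ix iy = ∪-increasing-∷ x xs ys ix iy
    ∪-increasing-∷ x xs [] ix _ = ix
    ∪-increasing-∷ x xs (y ∷ ys) (ax ∷ ix) (ay ∷ iy) with compare x y
    ... | tri< x≺y _ _ = All≺-∪ xs (y ∷ ys) ax (All≺-∷ ys x≺y ay) ∷ ∪-increasing xs (y ∷ ys) ix (ay ∷ iy)
    ... | tri≈ _ refl _ = All≺-∪ xs ys ax ay ∷ ∪-increasing xs ys ix iy
    ... | tri> _ _ y≺x = All≺-∪ (x ∷ xs) ys (All≺-∷ xs y≺x ax) ay ∷ ∪-increasing-∷ x xs ys (ax ∷ ix) iy

  ∪-sorted : ∀ {xs ys} → Sorted xs → Sorted ys → Sorted (xs ∪ ys)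
  ∪-sorted {xs} {ys} sx sy = Linkedₚ.AllPairs⇒Linked
    (∪-increasing xs ys (Linkedₚ.Linked⇒AllPairs ≺-trans sx) (Linkedₚ.Linked⇒AllPairs ≺-trans sy))

  sorted⇒unique : ∀ {xs} → Sorted xs → Unique xs
  sorted⇒unique s = AllPairs.map (λ x≺y x≡y → irrefl x≡y x≺y) (Linkedₚ.Linked⇒AllPairs ≺-trans s)

  unique-↭ : ∀ {xs ys : List Var} → Unique xs → Unique ys →
             (∀ {z} → z ∈ xs → z ∈ ys) → (∀ {z} → z ∈ ys → z ∈ xs) → xs ↭ ys
  unique-↭ {xs} {ys} ux uy to from =
    ∼bag⇒↭ (unique∧set⇒bag {xs = xs} {ys = ys} ux uy (λ {z} → mk⇔ (to {z}) (from {z})))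

  private
    ≼-totalOrder : TotalOrder 0ℓ 0ℓ 0ℓ
    ≼-totalOrder = record
      { Carrier = Var ; _≈_ = _≡_ ; _≤_ = StrictToNonStrict._≤_ _≡_ _≺_
      ; isTotalOrder = StrictToNonStrict.isTotalOrder _≡_ _≺_ isSTO }

  sorted-↭⇒≡ : ∀ {xs ys} → Sorted xs → Sorted ys → xs ↭ ys → xs ≡ ys
  sorted-↭⇒≡ sx sy p = ≋⇒≡ (SortedTotalOrder.↗↭↗⇒≋ ≼-totalOrder
    (Linked.map inj₁ sx) (Linked.map inj₁ sy) (↭⇒↭ₛ′ isEquivalence p))

  ∪-assoc : ∀ {xs ys zs} → Sorted xs → Sorted ys → Sorted zs → (xs ∪ ys) ∪ zs ≡ xs ∪ (ys ∪ zs)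
  ∪-assoc {xs} {ys} {zs} sx sy sz =
    sorted-↭⇒≡ sˡ sʳ (unique-↭ (sorted⇒unique sˡ) (sorted⇒unique sʳ) to from)
    where
    sˡ = ∪-sorted (∪-sorted sx sy) sz
    sʳ = ∪-sorted sx (∪-sorted sy sz)
    to : ∀ {z} → z ∈ (xs ∪ ys) ∪ zs → z ∈ xs ∪ (ys ∪ zs)
    to q with ∈-∪⁻ (xs ∪ ys) zs q
    ... | inj₂ r = ∈-∪⁺ʳ xs (ys ∪ zs) (∈-∪⁺ʳ ys zs r)
    ... | inj₁ r = [ ∈-∪⁺ˡ xs (ys ∪ zs) , (λ r′ → ∈-∪⁺ʳ xs (ys ∪ zs) (∈-∪⁺ˡ ys zs r′)) ] (∈-∪⁻ xs ys r)
    from : ∀ {z} → z ∈ xs ∪ (ys ∪ zs) → z ∈ (xs ∪ ys) ∪ zs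
    from q with ∈-∪⁻ xs (ys ∪ zs) q
    ... | inj₁ r = ∈-∪⁺ˡ (xs ∪ ys) zs (∈-∪⁺ˡ xs ys r)
    ... | inj₂ r = [ (λ r′ → ∈-∪⁺ˡ (xs ∪ ys) zs (∈-∪⁺ʳ xs ys r′)) , ∈-∪⁺ʳ (xs ∪ ys) zs ] (∈-∪⁻ ys zs r)

  ++-↭-∪ : ∀ {xs ys} → Sorted xs → Sorted ys → Disjoint xs ys → xs ++ ys ↭ xs ∪ ys
  ++-↭-∪ {xs} {ys} sx sy disj =
    unique-↭ (Unique.++⁺ (sorted⇒unique sx) (sorted⇒unique sy) (λ (p , q) → disj p q))
             (sorted⇒unique (∪-sorted sx sy))
             (λ q → [ ∈-∪⁺ˡ xs ys , ∈-∪⁺ʳ xs ys ] (∈.∈-++⁻ xs q))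
             (λ q → [ ∈.∈-++⁺ˡ , ∈.∈-++⁺ʳ xs ] (∈-∪⁻ xs ys q))

  ++-∖-↭ : ∀ {X Y} → Unique X → Unique Y → X ⊆ Y → X ++ (Y ∖ X) ↭ Y
  ++-∖-↭ {X} {Y} uX uY X⊆Y =
    unique-↭ (Unique.++⁺ uX (Unique.filter⁺ keep? uY) λ (p , q) → proj₂ (∈.∈-filter⁻ keep? {xs = Y} q) p)
             uY to from
    where
    keep? = λ y → ¬? (y ∈? X)
    to : ∀ {z} → z ∈ X ++ (Y ∖ X) → z ∈ Y
    to q = [ X⊆Y , (λ r → proj₁ (∈.∈-filter⁻ keep? {xs = Y} r)) ] (∈.∈-++⁻ X q)
    from : ∀ {z} → z ∈ Y → z ∈ X ++ (Y ∖ X)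
    from {z} q with z ∈? X
    ... | yes r = ∈.∈-++⁺ˡ r
    ... | no r = ∈.∈-++⁺ʳ X (∈.∈-filter⁺ keep? q r)

  ++-cancelˡ-↭ : ∀ (xs : List Var) {ys zs} → xs ++ ys ↭ xs ++ zs → ys ↭ zs
  ++-cancelˡ-↭ [] p = p
  ++-cancelˡ-↭ (x ∷ xs) p = ++-cancelˡ-↭ xs (Perm.drop-∷ p)

module Rewirings {o ℓ} (𝕍 : VarStructure) (ℂ : StrictMarkov o ℓ)
                 (θ : VarStructure.Var 𝕍 → StrictMarkov.Obj ℂ) where
  open VarStructure 𝕍
  open StrictMarkov ℂ
  open Transport ℂ
  open MonoidalFacts ℂ
  open Graphs ℂ

  ⟪_⟫ : List Var → Obj
  ⟪_⟫ = ⟦_⟧ 𝕍 ℂ θ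

  pm : ∀ {xs ys : List Var} → xs ↭ ys → Hom ⟪ xs ⟫ ⟪ ys ⟫
  pm = permMor 𝕍 ℂ θ

  ⊗θ-≈ : ∀ {xs ys us vs : List Var} (f : Hom ⟪ xs ⟫ ⟪ ys ⟫) (g : Hom ⟪ us ⟫ ⟪ vs ⟫) →
         _⊗θ_ 𝕍 ℂ θ {xs} {ys} {us} {vs} f g ≈ f ⊗₁ g
  ⊗θ-≈ f g = subst₂-≈ _ _ _

  copyθ-≈ : ∀ (xs : List Var) → copyθ 𝕍 ℂ θ xs ≈ copy {⟪ xs ⟫}
  copyθ-≈ xs = subst₂-≈ _ _ _

  ⟪++⟫ : ∀ (xs ys : List Var) → ⟪ xs ⟫ ⊗₀ ⟪ ys ⟫ ≡ ⟪ xs ++ ys ⟫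
  ⟪++⟫ xs ys = sym (⟦++⟧ 𝕍 ℂ θ xs ys)

  permMor-deterministic : ∀ {xs ys : List Var} (p : xs ↭ ys) → Deterministic (pm p)
  permMor-deterministic ↭.refl = deterministic-id
  permMor-deterministic (↭.prep x p) = deterministic-⊗ deterministic-id (permMor-deterministic p)
  permMor-deterministic (↭.swap x y p) =
    deterministic-subst₂ assoc₀ assoc₀ (deterministic-⊗ deterministic-σ (permMor-deterministic p))
  permMor-deterministic (↭.trans p q) = deterministic-∘ (permMor-deterministic p) (permMor-deterministic q)

  permMor-reflexive : ∀ {xs ys : List Var} (e : xs ≡ ys) → pm (↭-reflexive e) ≈ id {⟪ xs ⟫}
  permMor-reflexive refl = ≈-refl

  permMor-++⁺ʳ : ∀ {xs ys : List Var} zs (p : xs ↭ ys) → pm (Perm.++⁺ʳ zs p) ≈ pm p ⊗₁ id {⟪ zs ⟫}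
  permMor-++⁺ʳ {xs} zs ↭.refl = ≈-trans (id-≈ (sym (⟪++⟫ xs zs))) (≡⇒≈ (sym ⊗-id))
  permMor-++⁺ʳ zs (↭.prep x p) = ≈-trans (⊗-resp-≈ ≈-refl (permMor-++⁺ʳ zs p)) (≈-sym ⊗-assoc-≈)
  permMor-++⁺ʳ zs (↭.swap x y p) =
    ≈-trans (subst₂-≈ _ _ _) (≈-trans (⊗-resp-≈ ≈-refl (permMor-++⁺ʳ zs p))
      (≈-trans (≈-sym ⊗-assoc-≈) (⊗-resp-≈ (≈-sym (subst₂-≈ _ _ _)) ≈-refl)))
  permMor-++⁺ʳ zs (↭.trans p q) =
    ≈-trans (∘-resp-≈ (permMor-++⁺ʳ zs q) (permMor-++⁺ʳ zs p))
      (≡⇒≈ (trans ⊗-interchange (cong ((pm q ∘ pm p) ⊗₁_) identityˡ)))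

  permMor-++⁺ˡ : ∀ (zs : List Var) {xs ys} (p : xs ↭ ys) → pm (Perm.++⁺ˡ zs p) ≈ id {⟪ zs ⟫} ⊗₁ pm p
  permMor-++⁺ˡ [] p = ≈-sym ⊗-unitˡ-≈
  permMor-++⁺ˡ (z ∷ zs) p =
    ≈-trans (⊗-resp-≈ ≈-refl (permMor-++⁺ˡ zs p)) (≈-trans (≈-sym ⊗-assoc-≈) (⊗-resp-≈ (≡⇒≈ ⊗-id) ≈-refl))

  permMor-↭-sym : ∀ {xs ys : List Var} (p : xs ↭ ys) → pm (↭-sym p) ∘ pm p ≡ id
  permMor-↭-sym ↭.refl = identityˡ
  permMor-↭-sym (↭.prep x p) = trans ⊗-interchange (trans (cong₂ _⊗₁_ identityˡ (permMor-↭-sym p)) ⊗-id)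
  permMor-↭-sym (↭.swap x y p) =
    trans (subst₂-∘ assoc₀ assoc₀ assoc₀)
      (trans (cong (subst₂ Hom assoc₀ assoc₀)
                 (trans ⊗-interchange (trans (cong₂ _⊗₁_ σ-inv (permMor-↭-sym p)) ⊗-id)))
               (subst₂-id assoc₀))
    where
    subst₂-∘ : ∀ {A B C A′ B′ C′} (p : A ≡ A′) (q : B ≡ B′) (r : C ≡ C′) {f : Hom A B} {g : Hom B C} →
               subst₂ Hom q r g ∘ subst₂ Hom p q f ≡ subst₂ Hom p r (g ∘ f)
    subst₂-∘ refl refl refl = refl
    subst₂-id : ∀ {A A′} (p : A ≡ A′) → subst₂ Hom p p (id {A}) ≡ id
    subst₂-id refl = refl
  permMor-↭-sym (↭.trans p q) =
    trans assoc (trans (cong (pm (↭-sym p) ∘_)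
      (trans (sym assoc) (trans (cong (_∘ pm p) (permMor-↭-sym q)) identityˡ))) (permMor-↭-sym p))

  private
    ∷-shift : ∀ (w : Var) xs ys → w ∷ (xs ++ ys) ↭ xs ++ (w ∷ ys)
    ∷-shift w [] ys = ↭.refl
    ∷-shift w (x ∷ xs) ys = ↭.trans (↭.swap w x ↭.refl) (↭.prep x (∷-shift w xs ys))

    permMor-∷-shift : ∀ (w : Var) xs ys → pm (∷-shift w xs ys) ≈ σ {θ w} {⟪ xs ⟫} ⊗₁ id {⟪ ys ⟫}
    permMor-∷-shift w [] ys = ≈-sym (≈-trans (⊗-resp-≈ σ-unitʳ ≈-refl) (≡⇒≈ ⊗-id))
    permMor-∷-shift w (x ∷ xs) ys =
      ≈-trans (≡⇒≈ (cong ((id ⊗₁ pm (∷-shift w xs ys)) ∘_) (sym identityˡ)))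
        (≈-trans (∘-cast-resp-≈ refl (cong (_⊗₀ ⟪ ys ⟫) assoc₀) shifted swapped)
          (≈-sym (≈-trans (⊗-resp-≈ σ-⊗ʳ ≈-refl) (∘-cast-⊗id assoc₀ (cong (_⊗₀ ⟪ ys ⟫) assoc₀)))))
      where
      shifted : id {θ x} ⊗₁ pm (∷-shift w xs ys) ≈ (id {θ x} ⊗₁ σ {θ w} {⟪ xs ⟫}) ⊗₁ id {⟪ ys ⟫}
      shifted = ≈-trans (⊗-resp-≈ ≈-refl (permMor-∷-shift w xs ys)) (≈-sym ⊗-assoc-≈)
      swapped : subst₂ Hom assoc₀ assoc₀ (σ {θ w} {θ x} ⊗₁ pm {xs ++ ys} ↭.refl) ≈
                (σ {θ w} {θ x} ⊗₁ id {⟪ xs ⟫}) ⊗₁ id {⟪ ys ⟫}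
      swapped = ≈-trans (subst₂-≈ _ _ _)
        (≈-trans (⊗-resp-≈ ≈-refl (≈-trans (id-≈ (sym (⟪++⟫ xs ys))) (≡⇒≈ (sym ⊗-id)))) (≈-sym ⊗-assoc-≈))

  ++-swap : ∀ (xs ys : List Var) → xs ++ ys ↭ ys ++ xs
  ++-swap [] ys = ↭-reflexive (sym (List.++-identityʳ ys))
  ++-swap (x ∷ xs) ys = ↭.trans (↭.prep x (++-swap xs ys)) (∷-shift x ys xs)

  permMor-++-swap : ∀ (xs ys : List Var) → pm (++-swap xs ys) ≈ σ {⟪ xs ⟫} {⟪ ys ⟫}
  permMor-++-swap [] ys = ≈-trans (permMor-reflexive (sym (List.++-identityʳ ys))) (≈-sym σ-unitˡ)
  permMor-++-swap (x ∷ xs) ys =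
    ≈-trans (≡⇒≈ (cong (pm (∷-shift x ys xs) ∘_) (sym identityˡ)))
      (≈-trans (∘-cast-resp-≈ refl (sym assoc₀) (permMor-∷-shift x ys xs)
                                (⊗-resp-≈ ≈-refl (permMor-++-swap xs ys)))
        (≈-sym σ-⊗ˡ))

module Subkernels {o ℓ} (𝕍 : VarStructure) (ℂ : StrictMarkov o ℓ)
                  (θ : VarStructure.Var 𝕍 → StrictMarkov.Obj ℂ) where
  open VarStructure 𝕍
  open StrictMarkov ℂ
  open Transport ℂ
  open MonoidalFacts ℂ
  open Graphs ℂ
  open FiniteSets 𝕍
  open Rewirings 𝕍 ℂ θ

  -- Kernels with an arbitrary list A of new variables in place of Y ∖ X.
  RewiredGraph : ∀ X Y → Hom ⟪ X ⟫ ⟪ Y ⟫ → Set (o ⊔ ℓ)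
  RewiredGraph X Y h = Σ[ A ∈ List Var ] Σ[ c ∈ Hom ⟪ X ⟫ ⟪ A ⟫ ] Σ[ p ∈ X ++ A ↭ Y ]
    (h ≈ pm p ∘ cast (⟪++⟫ X A) ∘ graph c)

  permMor-rewiredGraph : ∀ {X Y} (q : X ↭ Y) → RewiredGraph X Y (pm q)
  permMor-rewiredGraph {X} q = [] , del , ↭.trans (↭-reflexive (List.++-identityʳ X)) q ,
    ≈-sym (≈-trans (≡⇒≈ assoc) (elimʳ (≈-trans (elimˡ (permMor-reflexive (List.++-identityʳ X)))
                                          (≈-trans (cast-elimˡ (⟪++⟫ X [])) copy-unitʳ-≈))))

  isKernel⇒rewiredGraph : ∀ {X Y} {h : Hom ⟪ X ⟫ ⟪ Y ⟫} → IsKernel 𝕍 ℂ θ X Y h → RewiredGraph X Y h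
  isKernel⇒rewiredGraph {X} {Y} (_ , f′ , s , (p , s≡p) , h≡) = Y ∖ X , f′ , p ,
    ≈-trans (≡⇒≈ h≡) (∘-resp-≈-castʳ (⟪++⟫ X (Y ∖ X)) (≡⇒≈ s≡p)
                       (∘-resp-≈ (⊗θ-≈ {X} {X} {X} {Y ∖ X} id f′) (copyθ-≈ X)))

  rewiredGraph⇒isKernel : ∀ {X Y} {h : Hom ⟪ X ⟫ ⟪ Y ⟫} → Sorted X → Sorted Y →
                          RewiredGraph X Y h → IsKernel 𝕍 ℂ θ X Y h
  rewiredGraph⇒isKernel {X} {Y} {h} sX sY (A , c , p , h≈) =
    X⊆Y , pm q ∘ c , pm p′ , (p′ , refl) , ≈⇒≡ (≈-trans h≈ (≈-sym (≈-trans (≡⇒≈ assoc)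
                                                  (∘-resp-≈-castʳ (⟪++⟫ X A) ≈-refl reorder))))
    where
    X⊆Y : X ⊆ Y
    X⊆Y x = Perm.∈-resp-↭ p (∈.∈-++⁺ˡ x)
    q : A ↭ Y ∖ X
    q = ++-cancelˡ-↭ X (↭.trans p (↭-sym (++-∖-↭ (sorted⇒unique sX) (sorted⇒unique sY) X⊆Y)))
    p′ : X ++ (Y ∖ X) ↭ Y
    p′ = ↭.trans (Perm.++⁺ˡ X (↭-sym q)) p
    reorder : pm (Perm.++⁺ˡ X (↭-sym q)) ∘ _⊗θ_ 𝕍 ℂ θ {X} {X} {X} {Y ∖ X} id (pm q ∘ c) ∘ copyθ 𝕍 ℂ θ X
              ≈ graph c
    reorder = ≈-trans (≡⇒≈ (sym assoc))
      (≈-trans (∘-resp-≈ (∘-resp-≈ (permMor-++⁺ˡ X (↭-sym q)) (⊗θ-≈ {X} {X} {X} {Y ∖ X} id (pm q ∘ c)))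
                         (copyθ-≈ X))
        (≡⇒≈ (cong (_∘ copy) (trans ⊗-interchange (cong₂ _⊗₁_ identityˡ
          (trans (sym assoc) (trans (cong (_∘ c) (permMor-↭-sym q)) identityˡ)))))))

  -- The rewiring in front of the first graph is deterministic, so it can be copied past; the new variables
  -- of the composite are those of both factors.
  rewiredGraph-∘ : ∀ {X Y W} {h : Hom ⟪ X ⟫ ⟪ Y ⟫} {h′ : Hom ⟪ Y ⟫ ⟪ W ⟫} →
                   RewiredGraph X Y h → RewiredGraph Y W h′ → RewiredGraph X W (h′ ∘ h)
  rewiredGraph-∘ {X} {Y} {W} {h} {h′} (A , a , p , h≈) (B , b , p′ , h′≈) =
    A ++ B , cast (⟪++⟫ A B) ∘ c , ↭.trans (↭-reflexive reassoc) (↭.trans (Perm.++⁺ʳ B p) p′) ,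
    ≈-trans lhs (≈-sym rhs)
    where
    P = pm p ∘ cast (⟪++⟫ X A)
    c = (id {⟪ A ⟫} ⊗₁ (b ∘ P)) ∘ cast assoc₀ ∘ copyGraph-tail a
    reassoc : X ++ (A ++ B) ≡ (X ++ A) ++ B
    reassoc = sym (List.++-assoc X A B)
    t : ⟪ X ⟫ ⊗₀ (⟪ A ⟫ ⊗₀ ⟪ B ⟫) ≡ ⟪ X ++ A ⟫ ⊗₀ ⟪ B ⟫
    t = trans (sym assoc₀) (cong (_⊗₀ ⟪ B ⟫) (⟪++⟫ X A))
    lhs : h′ ∘ h ≈ pm p′ ∘ cast (⟪++⟫ Y B) ∘ (pm p ⊗₁ id {⟪ B ⟫}) ∘ cast t ∘ graph c
    lhs = ≈-trans (∘-resp-≈ h′≈ h≈)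
      (≈-trans (≡⇒≈ (trans assoc (cong (pm p′ ∘_) (trans assoc (cong (cast (⟪++⟫ Y B) ∘_)
                      (cong (graph b ∘_) (sym assoc)))))))
      (∘-resp-≈ ≈-refl (∘-resp-≈ ≈-refl
        (≈-trans (graph-∘-deterministic-∘-graph b P a
                   (deterministic-∘ (deterministic-cast (⟪++⟫ X A)) (permMor-deterministic p)))
                 (∘-cast-resp-≈ (sym assoc₀) t (⊗-resp-≈ (cast-elimʳ (⟪++⟫ X A)) ≈-refl) ≈-refl)))))
    rhs : pm (↭.trans (↭-reflexive reassoc) (↭.trans (Perm.++⁺ʳ B p) p′)) ∘ cast (⟪++⟫ X (A ++ B))
            ∘ graph (cast (⟪++⟫ A B) ∘ c)
          ≈ pm p′ ∘ cast (⟪++⟫ Y B) ∘ (pm p ⊗₁ id {⟪ B ⟫}) ∘ cast t ∘ graph c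
    rhs = ≈-trans (≡⇒≈ (trans assoc assoc))
      (∘-resp-≈-castʳ (⟪++⟫ Y B) ≈-refl (∘-resp-≈-castʳ t (permMor-++⁺ʳ B p)
        (≈-trans (elimˡ (permMor-reflexive reassoc))
          (≈-trans (cast-elimˡ _) (∘-resp-≈ (⊗-resp-≈ ≈-refl (cast-elimˡ (⟪++⟫ A B))) ≈-refl)))))

  rewiredGraph-⊗id : ∀ {X Y} {h : Hom ⟪ X ⟫ ⟪ Y ⟫} W → RewiredGraph X Y h →
                     RewiredGraph (X ++ W) (Y ++ W) (_⊗θ_ 𝕍 ℂ θ {X} {Y} {W} {W} h (id {⟪ W ⟫}))
  rewiredGraph-⊗id {X} {Y} {h} W (A , a , p , h≈) = A , c , p′ , ≈-trans lhs (≈-sym rhs)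
    where
    c = cast unitʳ₀ ∘ (a ⊗₁ del {⟪ W ⟫}) ∘ cast (⟦++⟧ 𝕍 ℂ θ X W)
    p′ : (X ++ W) ++ A ↭ Y ++ W
    p′ = ↭.trans (↭-reflexive (List.++-assoc X W A))
           (↭.trans (Perm.++⁺ˡ X (++-swap W A))
             (↭.trans (↭-reflexive (sym (List.++-assoc X A W))) (Perm.++⁺ʳ W p)))
    s : (⟪ X ⟫ ⊗₀ ⟪ W ⟫) ⊗₀ (⟪ A ⟫ ⊗₀ I) ≡ ⟪ X ⟫ ⊗₀ (⟪ W ⟫ ⊗₀ ⟪ A ⟫)
    s = trans (cong ((⟪ X ⟫ ⊗₀ ⟪ W ⟫) ⊗₀_) unitʳ₀) assoc₀
    u : ⟪ X ⟫ ⊗₀ (⟪ A ⟫ ⊗₀ ⟪ W ⟫) ≡ ⟪ X ++ A ⟫ ⊗₀ ⟪ W ⟫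
    u = trans (sym assoc₀) (cong (_⊗₀ ⟪ W ⟫) (⟪++⟫ X A))
    T = (id {⟪ X ⟫} ⊗₁ σ {⟪ W ⟫} {⟪ A ⟫}) ∘ cast s ∘ graph (a ⊗₁ del {⟪ W ⟫})
    lhs : _⊗θ_ 𝕍 ℂ θ {X} {Y} {W} {W} h id ≈ (pm p ⊗₁ id {⟪ W ⟫}) ∘ cast u ∘ T
    lhs = ≈-trans (⊗θ-≈ {X} {Y} {W} {W} h id) (≈-trans (⊗-resp-≈ (≈-trans h≈ (≡⇒≈ (sym assoc))) ≈-refl)
            (≈-trans (graph-⊗id (pm p ∘ cast (⟪++⟫ X A)) a s)
              (∘-cast-resp-≈ (sym assoc₀) u (⊗-resp-≈ (cast-elimʳ (⟪++⟫ X A)) ≈-refl) ≈-refl)))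
    graph-c : pm (↭-reflexive (List.++-assoc X W A)) ∘ cast (⟪++⟫ (X ++ W) A) ∘ graph c
              ≈ graph (a ⊗₁ del {⟪ W ⟫})
    graph-c = ≈-trans (elimˡ (permMor-reflexive (List.++-assoc X W A)))
      (≈-trans (cast-elimˡ _)
        (∘-resp-≈ (⊗-resp-≈ (id-≈ (⟦++⟧ 𝕍 ℂ θ X W)) (≈-trans (cast-elimˡ _) (cast-elimʳ _)))
                  (copy-≈ (⟦++⟧ 𝕍 ℂ θ X W))))
    rhs : pm p′ ∘ cast (⟪++⟫ (X ++ W) A) ∘ graph c ≈ (pm p ⊗₁ id {⟪ W ⟫}) ∘ cast u ∘ T
    rhs = ≈-trans (≡⇒≈ (trans assoc (trans assoc assoc)))
      (∘-resp-≈-castʳ u (permMor-++⁺ʳ W p)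
        (≈-trans (elimˡ (permMor-reflexive (sym (List.++-assoc X A W))))
          (∘-resp-≈-castʳ s (≈-trans (permMor-++⁺ˡ X (++-swap W A)) (⊗-resp-≈ ≈-refl (permMor-++-swap W A)))
            graph-c)))

  extend : ∀ X Y Z → Homθ 𝕍 ℂ θ X Y → Homθ 𝕍 ℂ θ (X ++ Z) (Y ++ Z)
  extend X Y Z f = _⊗θ_ 𝕍 ℂ θ {X} {Y} {Z} {Z} f id

  extend-∘ : ∀ X Y W Z (f : Homθ 𝕍 ℂ θ X Y) (g : Homθ 𝕍 ℂ θ Y W) →
             extend X W Z (g ∘ f) ≡ extend Y W Z g ∘ extend X Y Z f
  extend-∘ X Y W Z f g = ≈⇒≡ (≈-trans (⊗θ-≈ {X} {W} {Z} {Z} _ _) (≈-trans (≡⇒≈ ∘-⊗id)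
                           (∘-resp-≈ (≈-sym (⊗θ-≈ {Y} {W} {Z} {Z} _ _)) (≈-sym (⊗θ-≈ {X} {Y} {Z} {Z} _ _)))))

  permMor-++⁺ʳ-extend : ∀ {X Y} Z (p : X ↭ Y) → pm (Perm.++⁺ʳ Z p) ≡ extend X Y Z (pm p)
  permMor-++⁺ʳ-extend {X} {Y} Z p = ≈⇒≡ (≈-trans (permMor-++⁺ʳ Z p) (≈-sym (⊗θ-≈ {X} {Y} {Z} {Z} _ _)))

  module _ {Z₁ Z₂ Z : List Var} (ρ : Z₁ ++ Z₂ ↭ Z) where
    merge : ∀ X → (X ++ Z₁) ++ Z₂ ↭ X ++ Z
    merge X = ↭.trans (↭-reflexive (List.++-assoc X Z₁ Z₂)) (Perm.++⁺ˡ X ρ)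

    unmerge : ∀ X → X ++ Z ↭ (X ++ Z₁) ++ Z₂
    unmerge X = ↭.trans (Perm.++⁺ˡ X (↭-sym ρ)) (↭-reflexive (sym (List.++-assoc X Z₁ Z₂)))

    extend-extend : ∀ X Y (f : Homθ 𝕍 ℂ θ X Y) →
                    extend (X ++ Z₁) (Y ++ Z₁) Z₂ (extend X Y Z₁ f) ≡ pm (unmerge Y) ∘ extend X Y Z f ∘ pm (merge X)
    extend-extend X Y f = ≈⇒≡ (≈-sym (begin
      pm (unmerge Y) ∘ extend X Y Z f ∘ pm (merge X)
        ≈⟨ ∘-resp-≈ (elimˡ (permMor-reflexive (sym (List.++-assoc Y Z₁ Z₂))))
             (∘-resp-≈ ≈-refl (elimʳ (permMor-reflexive (List.++-assoc X Z₁ Z₂)))) ⟩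
      pm (Perm.++⁺ˡ Y (↭-sym ρ)) ∘ extend X Y Z f ∘ pm (Perm.++⁺ˡ X ρ)
        ≈⟨ ∘-resp-≈ (permMor-++⁺ˡ Y (↭-sym ρ)) (∘-resp-≈ (⊗θ-≈ {X} {Y} {Z} {Z} f id) (permMor-++⁺ˡ X ρ)) ⟩
      (id ⊗₁ pm (↭-sym ρ)) ∘ (f ⊗₁ id) ∘ (id ⊗₁ pm ρ)
        ≡⟨ trans (sym assoc) (trans (cong (_∘ (id ⊗₁ pm ρ)) (sym ⊗-slide)) assoc) ⟩
      (f ⊗₁ id) ∘ (id ⊗₁ pm (↭-sym ρ)) ∘ (id ⊗₁ pm ρ)
        ≡⟨ cong ((f ⊗₁ id) ∘_) (trans (sym id⊗-∘) (trans (cong (id ⊗₁_) (permMor-↭-sym ρ)) ⊗-id)) ⟩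
      (f ⊗₁ id) ∘ id
        ≡⟨ identityʳ ⟩
      f ⊗₁ id {⟪ Z₁ ++ Z₂ ⟫}
        ≈⟨ ⊗-resp-≈ ≈-refl (≈-trans (id-≈ (⟦++⟧ 𝕍 ℂ θ Z₁ Z₂)) (≡⇒≈ (sym ⊗-id))) ⟩
      f ⊗₁ (id ⊗₁ id)
        ≈⟨ ≈-sym ⊗-assoc-≈ ⟩
      (f ⊗₁ id) ⊗₁ id
        ≈⟨ ≈-sym (≈-trans (⊗θ-≈ {X ++ Z₁} {Y ++ Z₁} {Z₂} {Z₂} _ id)
                          (⊗-resp-≈ (⊗θ-≈ {X} {Y} {Z₁} {Z₁} f id) ≈-refl)) ⟩
      extend (X ++ Z₁) (Y ++ Z₁) Z₂ (extend X Y Z₁ f) ∎))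
      where open ≈-Reasoning

    extend-∘-extend : ∀ {X₁ Y₁} X Y (f : Homθ 𝕍 ℂ θ X Y) (h : Homθ 𝕍 ℂ θ (Y ++ Z₁) Y₁) (p : X₁ ↭ X ++ Z₁) →
                      extend X₁ Y₁ Z₂ (h ∘ extend X Y Z₁ f ∘ pm p)
                      ≡ extend (Y ++ Z₁) Y₁ Z₂ h ∘ (pm (unmerge Y) ∘ extend X Y Z f ∘ pm (merge X))
                          ∘ pm (Perm.++⁺ʳ Z₂ p)
    extend-∘-extend {X₁} {Y₁} X Y f h p = begin
      extend X₁ Y₁ Z₂ (h ∘ extend X Y Z₁ f ∘ pm p)
        ≡⟨ extend-∘ X₁ (Y ++ Z₁) Y₁ Z₂ _ h ⟩
      extend (Y ++ Z₁) Y₁ Z₂ h ∘ extend X₁ (Y ++ Z₁) Z₂ (extend X Y Z₁ f ∘ pm p)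
        ≡⟨ cong (extend (Y ++ Z₁) Y₁ Z₂ h ∘_) (extend-∘ X₁ (X ++ Z₁) (Y ++ Z₁) Z₂ _ _) ⟩
      extend (Y ++ Z₁) Y₁ Z₂ h ∘ extend (X ++ Z₁) (Y ++ Z₁) Z₂ (extend X Y Z₁ f) ∘ extend X₁ (X ++ Z₁) Z₂ (pm p)
        ≡⟨ cong (extend (Y ++ Z₁) Y₁ Z₂ h ∘_) (cong₂ _∘_ (extend-extend X Y f) (sym (permMor-++⁺ʳ-extend Z₂ p))) ⟩
      extend (Y ++ Z₁) Y₁ Z₂ h ∘ (pm (unmerge Y) ∘ extend X Y Z f ∘ pm (merge X)) ∘ pm (Perm.++⁺ʳ Z₂ p) ∎
      where open ≡-Reasoning

  -- The rewirings of the definition of ⊑ only reorder variables, so it suffices to factor g through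
  -- f ⊗ id_Z with any permutation in front and any rewired graph behind.
  ⊑-intro : ∀ f g Z → Sorted Z → Disjoint Z (cod f) → dom g ≡ dom f ∪ Z →
            (p : dom g ↭ dom f ++ Z) (h : Homθ 𝕍 ℂ θ (cod f ++ Z) (cod g)) → RewiredGraph (cod f ++ Z) (cod g) h →
            mor g ≡ h ∘ extend (dom f) (cod f) Z (mor f) ∘ pm p → _⊑_ 𝕍 ℂ θ f g
  ⊑-intro f g Z sZ Z#C e p h h-graph g≡ =
    Z , sZ , Z#C , h ∘ pm (↭-sym σ₂) , h′-kernel , pm p′ , (p′ , refl) , pm σ₂ , (σ₂ , refl) , e , g≡′
    where
    σ₂ : cod f ++ Z ↭ cod f ∪ Z
    σ₂ = ++-↭-∪ (cod-set f) sZ (λ x∈C x∈Z → Z#C x∈Z x∈C)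
    h′-kernel = rewiredGraph⇒isKernel (∪-sorted (cod-set f) sZ) (cod-set g)
                  (rewiredGraph-∘ (permMor-rewiredGraph (↭-sym σ₂)) h-graph)
    p′ : dom f ∪ Z ↭ dom f ++ Z
    p′ = ↭.trans (↭-reflexive (sym e)) p
    subst-dom : ∀ {X Y W} (e : X ≡ Y) (m : Homθ 𝕍 ℂ θ X W) →
                subst (λ V → Homθ 𝕍 ℂ θ V W) e m ≡ m ∘ pm (↭-reflexive (sym e))
    subst-dom refl m = sym identityʳ
    F = extend (dom f) (cod f) Z (mor f)
    g≡′ : subst (λ V → Homθ 𝕍 ℂ θ V (cod g)) e (mor g) ≡ (h ∘ pm (↭-sym σ₂)) ∘ pm σ₂ ∘ F ∘ pm p′
    g≡′ = begin
      subst (λ V → Homθ 𝕍 ℂ θ V (cod g)) e (mor g) ≡⟨ subst-dom {W = cod g} e (mor g) ⟩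
      mor g ∘ pm (↭-reflexive (sym e))            ≡⟨ cong (_∘ _) g≡ ⟩
      (h ∘ F ∘ pm p) ∘ pm (↭-reflexive (sym e))   ≡⟨ trans assoc (cong (h ∘_) assoc) ⟩
      h ∘ F ∘ pm p′
        ≡⟨ cong (h ∘_) (sym (trans (cong (_∘ (F ∘ pm p′)) (permMor-↭-sym σ₂)) identityˡ)) ⟩
      h ∘ (pm (↭-sym σ₂) ∘ pm σ₂) ∘ F ∘ pm p′     ≡⟨ trans (cong (h ∘_) assoc) (sym assoc) ⟩
      (h ∘ pm (↭-sym σ₂)) ∘ pm σ₂ ∘ F ∘ pm p′ ∎
      where open ≡-Reasoning

  ⊑-refl : ∀ f → _⊑_ 𝕍 ℂ θ f f
  ⊑-refl f = ⊑-intro f f [] Linked.[] (λ ()) (sym (∪-identityʳ (dom f)))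
    (↭-reflexive (sym (List.++-identityʳ (dom f)))) (pm C[]≡C) (permMor-rewiredGraph C[]≡C)
    (≈⇒≡ (≈-sym (begin
      pm C[]≡C ∘ extend (dom f) (cod f) [] (mor f) ∘ pm (↭-reflexive (sym (List.++-identityʳ (dom f))))
        ≈⟨ elimˡ (permMor-reflexive (List.++-identityʳ (cod f))) ⟩
      extend (dom f) (cod f) [] (mor f) ∘ pm (↭-reflexive (sym (List.++-identityʳ (dom f))))
        ≈⟨ elimʳ (permMor-reflexive (sym (List.++-identityʳ (dom f)))) ⟩
      extend (dom f) (cod f) [] (mor f)
        ≈⟨ ≈-trans (⊗θ-≈ {dom f} {cod f} {[]} {[]} (mor f) id) ⊗-unitʳ-≈ ⟩
      mor f ∎)))
    where
    open ≈-Reasoning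
    C[]≡C = ↭-reflexive (List.++-identityʳ (cod f))

  -- Record patterns expose dom g and dom k as variables, so the domain equations of ⊑ can be matched on.
  ⊑-trans : ∀ f g k → _⊑_ 𝕍 ℂ θ f g → _⊑_ 𝕍 ℂ θ g k → _⊑_ 𝕍 ℂ θ f k
  ⊑-trans f record { cod = C′ ; mor = mg } k@record { mor = mk }
          (Z₁ , sZ₁ , Z₁#C , h₁ , h₁-kernel , _ , (p₁ , refl) , _ , (q₁ , refl) , refl , g≡)
          (Z₂ , sZ₂ , Z₂#C′ , h₂ , h₂-kernel , _ , (p₂ , refl) , _ , (q₂ , refl) , refl , k≡) =
    ⊑-intro f k (Z₁ ∪ Z₂) (∪-sorted sZ₁ sZ₂) Z#C (∪-assoc (dom-set f) sZ₁ sZ₂)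
      (↭.trans p₂ (↭.trans (Perm.++⁺ʳ Z₂ p₁) (merge ρ D))) (H ∘ pm (unmerge ρ C)) h-graph k≡′
    where
    D = dom f
    C = cod f
    C∪Z₁⊆C′ = proj₁ h₁-kernel
    Z#C : Disjoint (Z₁ ∪ Z₂) C
    Z#C z∈Z z∈C = [ (λ z∈Z₁ → Z₁#C z∈Z₁ z∈C) , (λ z∈Z₂ → Z₂#C′ z∈Z₂ (C∪Z₁⊆C′ (∈-∪⁺ˡ C Z₁ z∈C))) ]
                    (∈-∪⁻ Z₁ Z₂ z∈Z)
    ρ : Z₁ ++ Z₂ ↭ Z₁ ∪ Z₂
    ρ = ++-↭-∪ sZ₁ sZ₂ (λ z∈Z₁ z∈Z₂ → Z₂#C′ z∈Z₂ (C∪Z₁⊆C′ (∈-∪⁺ʳ C Z₁ z∈Z₁)))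
    G = extend (C ++ Z₁) C′ Z₂ (h₁ ∘ pm q₁)
    H = h₂ ∘ pm q₂ ∘ G
    h-graph = rewiredGraph-∘ (permMor-rewiredGraph (unmerge ρ C))
                (rewiredGraph-∘ (rewiredGraph-∘ G-graph (permMor-rewiredGraph q₂))
                                (isKernel⇒rewiredGraph h₂-kernel))
      where
      G-graph = rewiredGraph-⊗id Z₂
                  (rewiredGraph-∘ (permMor-rewiredGraph q₁) (isKernel⇒rewiredGraph h₁-kernel))
    F = extend D C (Z₁ ∪ Z₂) (mor f)
    k≡′ : mk ≡ (H ∘ pm (unmerge ρ C)) ∘ F ∘ pm (↭.trans p₂ (↭.trans (Perm.++⁺ʳ Z₂ p₁) (merge ρ D)))
    k≡′ = begin
      mk ≡⟨ k≡ ⟩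
      h₂ ∘ pm q₂ ∘ extend (D ∪ Z₁) C′ Z₂ mg ∘ pm p₂
        ≡⟨ cong (λ m → h₂ ∘ pm q₂ ∘ extend (D ∪ Z₁) C′ Z₂ m ∘ pm p₂) (trans g≡ (sym (assoc {f = extend D C Z₁ (mor f) ∘ pm p₁}))) ⟩
      h₂ ∘ pm q₂ ∘ extend (D ∪ Z₁) C′ Z₂ ((h₁ ∘ pm q₁) ∘ extend D C Z₁ (mor f) ∘ pm p₁) ∘ pm p₂
        ≡⟨ cong (λ m → h₂ ∘ pm q₂ ∘ m ∘ pm p₂) (extend-∘-extend ρ {D ∪ Z₁} {C′} D C (mor f) (h₁ ∘ pm q₁) p₁) ⟩
      h₂ ∘ pm q₂ ∘ (G ∘ (pm (unmerge ρ C) ∘ F ∘ pm (merge ρ D)) ∘ pm (Perm.++⁺ʳ Z₂ p₁)) ∘ pm p₂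
        ≡⟨ trans (cong (λ m → h₂ ∘ pm q₂ ∘ m) (trans assoc (cong (G ∘_)
             (trans (cong (_∘ pm p₂) (trans assoc (cong (pm (unmerge ρ C) ∘_) assoc)))
                      (trans assoc (cong (pm (unmerge ρ C) ∘_) assoc))))))
             (sym (trans assoc (trans assoc (cong (h₂ ∘_) assoc)))) ⟩
      (H ∘ pm (unmerge ρ C)) ∘ F ∘ (pm (merge ρ D) ∘ pm (Perm.++⁺ʳ Z₂ p₁)) ∘ pm p₂ ∎
      where open ≡-Reasoning

proposition13 : ∀ {o ℓ : Level} (𝕍 : VarStructure) (ℂ : StrictMarkov o ℓ)
                  (θ : VarStructure.Var 𝕍 → StrictMarkov.Obj ℂ) →
                  (∀ (f : Kernel 𝕍 ℂ θ) → _⊑_ 𝕍 ℂ θ f f) ×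
                  (∀ (f g k : Kernel 𝕍 ℂ θ) → _⊑_ 𝕍 ℂ θ f g → _⊑_ 𝕍 ℂ θ g k → _⊑_ 𝕍 ℂ θ f k)
proposition13 𝕍 ℂ θ = Subkernels.⊑-refl 𝕍 ℂ θ , Subkernels.⊑-trans 𝕍 ℂ θ
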